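{- Let $E\subseteq \mathcal{A}$ and $F\subseteq \mathcal{F}$ be finite sets such that: (1) $\{(\!(0,0)\!),(\!(1,1,1)\!)\}\subseteq E$; (2) for every quiddity cycle $c\in\mathcal{A}$, either $c\in E$ or there exists $f\in F$ with $f\subsetneq c$; (3) every $f\in F$ has at least one entry equal to $1$. Put \[ E' := E\cup \delta^{ -1}(\overline{\psi}(E)), \qquad F' := \rho^{ -1}(\iota(\psi(F))). \] Then $E'$ and $F'$ are finite sets with $E'\subseteq\mathcal{A}$ and $F'\subseteq\mathcal{F}$, they satisfy properties (1), (2), (3) (with $E',F'$ in place of $E,F$), and \[ \min\{\text{length of } f \mid f\in F\} < \min\{\text{length of } f\mid f\in F'\}. \]
   Context: Let $\mathbb{N}=\{1,2,\dots\}$, $\mathbb{N}_0=\mathbb{N}\cup\{0\}$. For $n\in\mathbb{N}$ let $\mathcal{F}_n:=\mathbb{N}_0^n$ and $\mathcal{F}:=\bigcup_{n\in\mathbb{N}}\mathcal{F}_n$ (finite sequences; the length of $(c_1,\dots,c_n)$ is $n$). Let $\mathcal{D}_n$ be the set of orbits of $\mathcal{F}_n$ under the dihedral group acting on positions (generated by rotation $(c_1,\dots,c_n)\mapsto(c_2,\dots,c_n,c_1)$ and reversal $(c_1,\dots,c_n)\mapsto(c_n,\dots,c_1)$), and $\mathcal{D}:=\bigcup_n\mathcal{D}_n$. Write $(\!(c_1,\dots,c_n)\!)$ for the class of $(c_1,\dots,c_n)$; its elements are called representatives. All notions on $\mathcal{D}$ are via representatives, with positions read cyclically (the last and first positions are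 adjacent). Containment: $d=(d_1,\dots,d_m)\in\mathcal{F}$ is contained in $c\in\mathcal{D}$, written $d\subseteq c$, if there are a representative $(c_1,\dots,c_n)$ of $c$ and $k\in\mathbb{N}_0$ with $c_{k+i}=d_i$ for $i=1,\dots,m$ (indices taken cyclically modulo $n$). $d\subsetneq c$ means $d\subseteq c$ and $d$ is not itself a representative of $c$. Quiddity cycles: $\mathcal{A}\subseteq\mathcal{D}$ is the smallest subset such that $(\!(0,0)\!)\in\mathcal{A}$ and, whenever $(\!(c_1,\dots,c_n)\!)\in\mathcal{A}$ (any representative), also $(\!(c_1+1,1,c_2+1,c_3,\dots,c_n)\!)\in\mathcal{A}$. Maps: $\psi:\mathcal{F}\to\mathcal{F}$, $(c_1,c_2,\dots,c_n)\mapsto(c_1+2,1,c_2+2,1,\dots,c_n+2,1)$; it induces $\overline{\psi}:\mathcal{A}\to\mathcal{D}$, $(\!(c_1,\dots,c_n)\!)\mapsto(\!(c_1+2,1,\dots,c_n+2,1)\!)$. For $c=(c_1,1,c_3,1,\dots)\in\mathcal{F}_n$ (all even-position entries equal $1$), $\iota(c):=(1,c_1,1,c_3,1,\dots)\in\mathcal{F}_{n+1}$. The map $\rho:\mathcal{F}\to\mathcal{F}$ sends $c=(c_1,\dots,c_n)$ to the sequence obtained by repeatedly applying the following replacements until none applies: (i) $(\dots,c_i,c_{i+1},\dots)\to(\dots,c_i+1,1,c_{i+1}+1,\dots)$ if $c_i,c_{i+1}>1$; (ii) $(c_1,\dots)\to(1,c_1+1,\dots)$ if $c_1>1$; (iii)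 $(\dots,c_n)\to(\dots,c_n+1,1)$ if $c_n>1$. The map $\delta:\mathcal{D}\setminus\{(\!(0,0)\!),(\!(1,1,1)\!)\}\to\mathcal{D}$ sends $c$ to the class obtained by repeatedly applying, until none applies: (i) $(\!(\dots,c_i,c_{i+1},\dots)\!)\mapsto(\!(\dots,c_i+1,1,c_{i+1}+1,\dots)\!)$ if $c_i,c_{i+1}>1$; (ii) $(\!(c_1,\dots,c_n)\!)\mapsto(\!(c_1+1,c_2,\dots,c_{n-1},c_n+1,1)\!)$ if $c_1,c_n>1$. Preimages $\rho^{ -1}(X)=\{f\in\mathcal{F}:\rho(f)\in X\}$, $\delta^{ -1}(Y)=\{c:\delta(c)\in Y\}$. -}

module Defs where

open import Data.Nat using (ℕ; zero; suc; _<_; _+_)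
open import Data.Nat.DivMod using (_%_)
open import Data.List using (List; []; _∷_; _++_; reverse; length; concatMap)
open import Data.List.Relation.Unary.Any using (Any)
open import Data.List.Relation.Unary.All using (All)
open import Data.List.Membership.Propositional using (_∈_)
open import Data.Product using (Σ; ∃; _×_; _,_)
open import Data.Sum using (_⊎_)
open import Relation.Nullary using (¬_)
open import Relation.Binary.PropositionalEquality using (_≡_)
open import Relation.Binary.Construct.Closure.ReflexiveTransitive using (Star)

-- Finite sequences (elements of 𝓕) are nonempty lists of naturals.
NonEmpty : List ℕ → Set
NonEmpty c = 0 < length c

-- Dihedral classes (elements of 𝓓), handled through representatives.

rot : List ℕ → List ℕ
rot []       = []
rot (x ∷ xs) = xs ++ (x ∷ [])

rotN : ℕ → List ℕ → List ℕ
rotN zero    c = c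
rotN (suc k) c = rot (rotN k c)

Dih : List ℕ → List ℕ → Set
Dih c d = ∃ λ k → (d ≡ rotN k c) ⊎ (d ≡ reverse (rotN k c))

-- membership of a class ((c)) in a finite set of classes given by a
-- list of representatives
_∈ᶜ_ : List ℕ → List (List ℕ) → Set
c ∈ᶜ E = Any (λ e → Dih e c) E

data QC : List ℕ → Set where
  qc-base : QC (0 ∷ 0 ∷ [])
  qc-step : ∀ {c₁ c₂ rest} → QC (c₁ ∷ c₂ ∷ rest) →
            QC (suc c₁ ∷ 1 ∷ suc c₂ ∷ rest)
  qc-dih  : ∀ {c d} → QC c → Dih c d → QC d

-- 0-indexed entry (default 0 out of range; only used in range)
nth : List ℕ → ℕ → ℕ
nth []       _       = 0
nth (x ∷ xs) zero    = x
nth (x ∷ xs) (suc i) = nth xs i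

cycAt : List ℕ → ℕ → ℕ
cycAt []         j = 0
cycAt (x ∷ xs) j = nth (x ∷ xs) (j % suc (length xs))

_⊆ᶜ_ : List ℕ → List ℕ → Set
d ⊆ᶜ c = ∃ λ c' → Dih c c' × ∃ λ k →
           ∀ i → i < length d → nth d i ≡ cycAt c' (k + i)

_⊊ᶜ_ : List ℕ → List ℕ → Set
d ⊊ᶜ c = d ⊆ᶜ c × ¬ Dih c d

ψ : List ℕ → List ℕ
ψ = concatMap (λ x → (x + 2) ∷ 1 ∷ [])

-- ι (c₁,1,c₃,1,…) = (1,c₁,1,c₃,1,…); only applied to ψ(f), whose
-- even positions are all 1.
ι : List ℕ → List ℕ
ι c = 1 ∷ c

data ρStep : List ℕ → List ℕ → Set where
  ρ-i   : ∀ pre a b post → 1 < a → 1 < b →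
          ρStep (pre ++ a ∷ b ∷ post) (pre ++ suc a ∷ 1 ∷ suc b ∷ post)
  ρ-ii  : ∀ a rest → 1 < a → ρStep (a ∷ rest) (1 ∷ suc a ∷ rest)
  ρ-iii : ∀ rest a → 1 < a → ρStep (rest ++ a ∷ []) (rest ++ suc a ∷ 1 ∷ [])

ρRel : List ℕ → List ℕ → Set
ρRel f g = Star ρStep f g × (∀ h → ¬ ρStep g h)

data CycStep : List ℕ → List ℕ → Set where
  δ-i  : ∀ pre a b post → 1 < a → 1 < b →
         CycStep (pre ++ a ∷ b ∷ post) (pre ++ suc a ∷ 1 ∷ suc b ∷ post)
  δ-ii : ∀ a mid b → 1 < a → 1 < b →
         CycStep (a ∷ (mid ++ b ∷ [])) (suc a ∷ (mid ++ suc b ∷ 1 ∷ []))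

δStep : List ℕ → List ℕ → Set
δStep c d = ∃ λ c' → Dih c c' × CycStep c' d

δRel : List ℕ → List ℕ → Set
δRel c g = Star δStep c g × (∀ h → ¬ δStep g h)

Hyps : List (List ℕ) → List (List ℕ) → Set
Hyps E F =
    All QC E
  × All NonEmpty F
  × ((0 ∷ 0 ∷ []) ∈ᶜ E × (1 ∷ 1 ∷ 1 ∷ []) ∈ᶜ E)
  × (∀ c → QC c → c ∈ᶜ E ⊎ (∃ λ f → f ∈ F × f ⊊ᶜ c))
  × All (λ f → 1 ∈ f) F

-- E' = E ∪ δ⁻¹(ψ̄(E))  and  F' = ρ⁻¹(ι(ψ(F))), as predicates.

InψE : List (List ℕ) → List ℕ → Set
InψE E g = Any (λ e → Dih (ψ e) g) E

InδInv : List (List ℕ) → List ℕ → Set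
InδInv E c = NonEmpty c
           × ¬ Dih (0 ∷ 0 ∷ []) c
           × ¬ Dih (1 ∷ 1 ∷ 1 ∷ []) c
           × ∃ λ g → δRel c g × InψE E g

InE' : List (List ℕ) → List ℕ → Set
InE' E c = c ∈ᶜ E ⊎ InδInv E c

InF' : List (List ℕ) → List ℕ → Set
InF' F f = NonEmpty f × ∃ λ g → ρRel f g × Any (λ h → g ≡ ι (ψ h)) F

-- A cycle without two adjacent 1s is, up to symmetry, spelled out by blocks: entries x > 1, each
-- possibly followed by a single 1. Every quiddity cycle of length at least 4 has this shape, and δ
-- fills each gap between two adjacent big entries with an ear; so δ maps the expansion of blocks P
-- to ψ(c), where c = contractCycle P deletes the 1s and lowers every entry by the number of 1s next
-- to it, and every δ-preimage of a representative of ψ(c) is such an expansion. Inserting and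
-- removing ears preserves quiddity cycles, hence so do expanding and contracting. A quiddity cycle
-- outside E′ thus contracts to a quiddity cycle outside E, which properly contains some f ∈ F; the
-- part of the expansion lying over f is properly contained in the original cycle, and ρ maps it to
-- ι(ψ(f)). The ρ-preimages of ι(ψ(h)) are again expansions, with a flag for a leading 1, so E′ and
-- F′ are finite enumerations over flag vectors; and as a 1 in h has a 1 next to it in any such
-- preimage, the preimage is longer than h.

module Submission where

open import Defs
open import Data.Bool using (Bool; true; false)
open import Data.Empty using (⊥; ⊥-elim)
open import Data.List
  using (List; []; _∷_; _++_; _∷ʳ_; _∷ʳ′_; initLast; reverse; length; map; concatMap; take; drop; filter;
         cartesianProductWith)
open import Data.List.Properties
open import Data.List.Membership.Propositional using (_∈_; find; lose)
open import Data.List.Relation.Unary.All as All using (All; []; _∷_; all?)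
import Data.List.Relation.Unary.All.Properties as AllP
open import Data.List.Relation.Unary.Any using (Any; here; there)
import Data.List.Relation.Unary.Any.Properties as AnyP
open import Data.List.Membership.Propositional.Properties
  using (∈-++⁺ˡ; ∈-++⁺ʳ; ∈-++⁻; ∈-map⁺; ∈-map⁻; ∈-concatMap⁺; ∈-concatMap⁻; ∈-map∘filter⁺; ∈-map∘filter⁻;
         ∈-cartesianProductWith⁺; ∈-cartesianProductWith⁻)
open import Data.List.Relation.Binary.Permutation.Propositional using (_↭_; ↭-sym; ↭-trans)
import Data.List.Relation.Binary.Permutation.Propositional.Properties as Perm
open import Data.Nat using (ℕ; zero; suc; _+_; _∸_; _*_; _<_; _≤_; s≤s; z≤n; s≤s⁻¹; _<?_)
open import Data.Nat.Properties
open import Data.List.Extrema ≤-totalOrder using (argmin; argmin-sel; f[argmin]≤v⁺)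
open import Data.Nat.DivMod using (_%_; m<n⇒m%n≡m; [m+n]%n≡m%n; m%n%n≡m%n; %-distribˡ-+; m%n<n)
open import Data.Nat.ListAction using (sum)
open import Data.Nat.ListAction.Properties using (sum-↭)
open import Data.Nat.Tactic.RingSolver using (solve-∀)
open import Data.Product using (∃; _×_; _,_; proj₁; proj₂)
open import Data.Sum using (_⊎_; inj₁; inj₂)
open import Data.Unit using (⊤; tt)
open import Function using (_∘_)
open import Relation.Binary using (tri<; tri≈; tri>)
open import Relation.Binary.PropositionalEquality
open import Relation.Binary.Construct.Closure.ReflexiveTransitive using (Star; ε; _◅_; _◅◅_)
open import Relation.Nullary using (¬_; Dec; yes; no)

-- Dihedral orbits

rotN-suc : ∀ k (c : List ℕ) → rotN (suc k) c ≡ rotN k (rot c)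
rotN-suc zero    c = refl
rotN-suc (suc k) c = cong rot (rotN-suc k c)

rotN-++ : ∀ (u v : List ℕ) → rotN (length u) (u ++ v) ≡ v ++ u
rotN-++ []      v = sym (++-identityʳ v)
rotN-++ (x ∷ u) v = begin
  rotN (suc (length u)) (x ∷ u ++ v)   ≡⟨ rotN-suc (length u) (x ∷ u ++ v) ⟩
  rotN (length u) ((u ++ v) ++ x ∷ []) ≡⟨ cong (rotN (length u)) (++-assoc u v (x ∷ [])) ⟩
  rotN (length u) (u ++ v ++ x ∷ [])   ≡⟨ rotN-++ u (v ++ x ∷ []) ⟩
  (v ++ x ∷ []) ++ u                   ≡⟨ ++-assoc v (x ∷ []) u ⟩
  v ++ x ∷ u                           ∎
  where open ≡-Reasoning

rotN-+ : ∀ k j (c : List ℕ) → rotN k (rotN j c) ≡ rotN (k + j) c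
rotN-+ zero    j c = refl
rotN-+ (suc k) j c = cong rot (rotN-+ k j c)

rotN-split : ∀ k (c : List ℕ) → ∃ λ u → ∃ λ v → c ≡ u ++ v × rotN k c ≡ v ++ u
rotN-split zero    c = [] , c , refl , sym (++-identityʳ c)
rotN-split (suc k) c with rotN-split k c
... | [] , [] , c≡ , r≡ = [] , [] , c≡ , cong rot r≡
... | x ∷ u , [] , c≡ , r≡ = x ∷ [] , u , trans c≡ (++-identityʳ (x ∷ u)) , cong rot r≡
... | u , x ∷ v , c≡ , r≡ =
  u ++ x ∷ [] , v , trans c≡ (sym (++-assoc u (x ∷ []) v)) , trans (cong rot r≡) (++-assoc v u (x ∷ []))

rot-reverse : ∀ (s : List ℕ) → ∃ λ j → rot (reverse s) ≡ reverse (rotN j s)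
rot-reverse s with initLast s
... | []         = 0 , refl
... | init ∷ʳ′ y = length init , (begin
  rot (reverse (init ∷ʳ y))                ≡⟨ cong rot (reverse-++ init (y ∷ [])) ⟩
  reverse init ++ y ∷ []                   ≡⟨ unfold-reverse y init ⟨
  reverse (y ∷ init)                       ≡⟨ cong reverse (rotN-++ init (y ∷ [])) ⟨
  reverse (rotN (length init) (init ∷ʳ y)) ∎)
  where open ≡-Reasoning

Dih-refl : ∀ c → Dih c c
Dih-refl c = 0 , inj₁ refl

Dih-rot : ∀ {c d} → Dih c d → Dih c (rot d)
Dih-rot (k , inj₁ e) = suc k , inj₁ (cong rot e)
Dih-rot {c} (k , inj₂ e) with rot-reverse (rotN k c)
... | j , e′ = j + k , inj₂ (trans (cong rot e) (trans e′ (cong reverse (rotN-+ j k c))))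

Dih-rotN : ∀ {c d} k → Dih c d → Dih c (rotN k d)
Dih-rotN zero    h = h
Dih-rotN (suc k) h = Dih-rot (Dih-rotN k h)

Dih-reverse : ∀ {c d} → Dih c d → Dih c (reverse d)
Dih-reverse (k , inj₁ e) = k , inj₂ (cong reverse e)
Dih-reverse {c} (k , inj₂ e) = k , inj₁ (trans (cong reverse e) (reverse-involutive (rotN k c)))

Dih-trans : ∀ {c d e} → Dih c d → Dih d e → Dih c e
Dih-trans h (j , inj₁ e) = subst (Dih _) (sym e) (Dih-rotN j h)
Dih-trans h (j , inj₂ e) = subst (Dih _) (sym e) (Dih-reverse (Dih-rotN j h))

Dih-swap : ∀ (u v : List ℕ) → Dih (u ++ v) (v ++ u)
Dih-swap u v = length u , inj₁ (sym (rotN-++ u v))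

Dih-sym : ∀ {c d} → Dih c d → Dih d c
Dih-sym {c} (k , inj₁ e) with rotN-split k c
... | u , v , c≡ , r≡ = subst₂ Dih (sym (trans e r≡)) (sym c≡) (Dih-swap v u)
Dih-sym {c} {d} (k , inj₂ e) with rotN-split k c
... | u , v , c≡ , r≡ = Dih-trans (Dih-reverse (Dih-refl d))
  (subst₂ Dih (sym (trans (cong reverse e) (trans (reverse-involutive _) r≡))) (sym c≡) (Dih-swap v u))

Dih⇒↭ : ∀ {c d} → Dih c d → c ↭ d
Dih⇒↭ {c} (k , inj₁ e) with rotN-split k c
... | u , v , c≡ , r≡ = subst₂ _↭_ (sym c≡) (sym (trans e r≡)) (Perm.++-comm u v)
Dih⇒↭ {c} (k , inj₂ e) with rotN-split k c
... | u , v , c≡ , r≡ = subst₂ _↭_ (sym c≡) (sym (trans e (cong reverse r≡)))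
  (↭-trans (Perm.++-comm u v) (↭-sym (Perm.↭-reverse (v ++ u))))

Dih-length : ∀ {c d} → Dih c d → length d ≡ length c
Dih-length h = sym (Perm.↭-length (Dih⇒↭ h))

-- Quiddity cycles

QC-sum : ∀ {c} → QC c → sum c + 6 ≡ 3 * length c
QC-sum qc-base = refl
QC-sum (qc-step {c₁} {c₂} {rest} q) = begin
  suc c₁ + (1 + (suc c₂ + sum rest)) + 6 ≡⟨ regroup c₁ c₂ (sum rest) ⟩
  3 + (c₁ + (c₂ + sum rest) + 6)         ≡⟨ cong (3 +_) (QC-sum q) ⟩
  3 + 3 * length (c₁ ∷ c₂ ∷ rest)        ≡⟨ *-suc 3 (length (c₁ ∷ c₂ ∷ rest)) ⟨
  3 * length (suc c₁ ∷ 1 ∷ suc c₂ ∷ rest) ∎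
  where
  open ≡-Reasoning
  regroup : ∀ a b s → suc a + (1 + (suc b + s)) + 6 ≡ 3 + (a + (b + s) + 6)
  regroup = solve-∀
QC-sum (qc-dih q h) =
  trans (cong (_+ 6) (sum-↭ (↭-sym (Dih⇒↭ h)))) (trans (QC-sum q) (cong (3 *_) (sym (Dih-length h))))

QC-length≥2 : ∀ {c} → QC c → 2 ≤ length c
QC-length≥2 {c} q = *-cancelˡ-≤ 3 (≤-trans (m≤n+m 6 (sum c)) (≤-reflexive (QC-sum q)))

QC-positive : ∀ {c} → QC c → 3 ≤ length c → All (0 <_) c
QC-positive qc-base (s≤s (s≤s ()))
QC-positive (qc-step {rest = []} q) _ = s≤s z≤n ∷ s≤s z≤n ∷ s≤s z≤n ∷ []
QC-positive (qc-step {rest = _ ∷ _} q) _ with QC-positive q (s≤s (s≤s (s≤s z≤n)))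
... | _ ∷ _ ∷ pos = s≤s z≤n ∷ s≤s z≤n ∷ s≤s z≤n ∷ pos
QC-positive (qc-dih q h) l =
  Perm.All-resp-↭ (Dih⇒↭ h) (QC-positive q (subst (3 ≤_) (Dih-length h) l))

QC-pair : ∀ {a b} → QC (a ∷ b ∷ []) → a ≡ 0 × b ≡ 0
QC-pair {a} {b} q = m+n≡0⇒m≡0 a a+b≡0 , m+n≡0⇒n≡0 a a+b≡0
  where
  a+b≡0 : a + b ≡ 0
  a+b≡0 = +-cancelʳ-≡ 6 (a + b) 0 (trans (cong (λ z → a + z + 6) (sym (+-identityʳ b))) (QC-sum q))

QC-triple : ∀ {a b c} → QC (a ∷ b ∷ c ∷ []) → a ≡ 1 × b ≡ 1 × c ≡ 1
QC-triple q with QC-positive q (s≤s (s≤s (s≤s z≤n))) | QC-sum q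
... | s≤s {n = x} _ ∷ s≤s {n = y} _ ∷ s≤s {n = z} _ ∷ [] | e =
  cong suc (m+n≡0⇒m≡0 x sum≡0) ,
  cong suc (m+n≡0⇒m≡0 y (m+n≡0⇒n≡0 x sum≡0)) ,
  cong suc (m+n≡0⇒n≡0 y (m+n≡0⇒n≡0 x sum≡0))
  where
  regroup : ∀ x y z → suc x + (suc y + (suc z + 0)) + 6 ≡ x + (y + z) + 9
  regroup = solve-∀
  sum≡0 : x + (y + z) ≡ 0
  sum≡0 = +-cancelʳ-≡ 9 (x + (y + z)) 0 (trans (sym (regroup x y z)) e)

QC-head≢0 : ∀ {b r} → QC (0 ∷ b ∷ r) → 0 < length r → ⊥
QC-head≢0 {r = _ ∷ _} q _ with QC-positive q (s≤s (s≤s (s≤s z≤n)))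
... | () ∷ _

0<length-++-∷ : ∀ (u : List ℕ) x w → 0 < length (u ++ x ∷ w)
0<length-++-∷ []      x w = s≤s z≤n
0<length-++-∷ (_ ∷ u) x w = s≤s z≤n

QC-insertEar : ∀ pre a b post → QC (pre ++ a ∷ b ∷ post) → QC (pre ++ suc a ∷ 1 ∷ suc b ∷ post)
QC-insertEar pre a b post q =
  qc-dih (qc-step (qc-dih q (Dih-swap pre (a ∷ b ∷ post)))) (Dih-swap (suc a ∷ 1 ∷ suc b ∷ post) pre)

QC-insertEarAtEnd : ∀ a mid b → QC (a ∷ mid ++ b ∷ []) → QC (suc a ∷ mid ++ suc b ∷ 1 ∷ [])
QC-insertEarAtEnd a mid b q =
  qc-dih (qc-step (qc-dih q (Dih-swap (a ∷ mid) (b ∷ [])))) (Dih-swap (suc b ∷ 1 ∷ []) (suc a ∷ mid))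

EarCuttable : List ℕ → Set
EarCuttable d = ∀ a b post → d ≡ suc a ∷ 1 ∷ suc b ∷ post → QC (a ∷ b ∷ post)

OrbitEarCuttable : List ℕ → Set
OrbitEarCuttable c = ∀ d → Dih c d → EarCuttable d

-- Offsets are counted from the newest ear (c₁+1, 1, c₂+1) of the cycle; an ear elsewhere is
-- cut before the newest ear is inserted, and the newest ear is inserted again afterwards.

cutEar-offset1 : ∀ c₁ c₂ rest a b post → QC (c₁ ∷ c₂ ∷ rest) →
                 (1 ∷ suc c₂ ∷ rest) ++ suc c₁ ∷ [] ≡ suc a ∷ 1 ∷ suc b ∷ post → QC (a ∷ b ∷ post)
cutEar-offset1 c₁ c₂ []      a b post q refl with QC-pair q
... | refl , _ = qc-base
cutEar-offset1 c₁ c₂ (r ∷ rest) a b post q refl =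
  ⊥-elim (QC-head≢0 (qc-dih q (Dih-swap (c₁ ∷ []) (0 ∷ r ∷ rest))) (0<length-++-∷ rest c₁ []))

cutEar-offset2 : ∀ c₁ c₂ rest a b post → QC (c₁ ∷ c₂ ∷ rest) → OrbitEarCuttable (c₁ ∷ c₂ ∷ rest) →
                 (suc c₂ ∷ rest) ++ suc c₁ ∷ 1 ∷ [] ≡ suc a ∷ 1 ∷ suc b ∷ post → QC (a ∷ b ∷ post)
cutEar-offset2 c₁ c₂ [] a b post q ih refl with QC-pair q
... | _ , refl = qc-base
cutEar-offset2 c₁ c₂ (r ∷ []) a b post q ih refl =
  qc-dih q (Dih-trans (Dih-reverse (Dih-refl _)) (Dih-swap (1 ∷ []) (c₂ ∷ c₁ ∷ [])))
cutEar-offset2 zero c₂ (_ ∷ _ ∷ _) a b post q ih e = ⊥-elim (QC-head≢0 q (s≤s z≤n))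
cutEar-offset2 (suc c₁) zero (r ∷ z ∷ rest) a b post q ih e
  with QC-positive q (s≤s (s≤s (s≤s z≤n)))
... | _ ∷ () ∷ _
cutEar-offset2 (suc c₁) (suc c₂) (r ∷ z ∷ rest) a b post q ih refl =
  QC-insertEarAtEnd c₂ (b ∷ rest) (suc c₁)
    (ih (suc c₂ ∷ 1 ∷ suc b ∷ rest ++ suc c₁ ∷ [])
        (Dih-swap (suc c₁ ∷ []) (suc c₂ ∷ 1 ∷ suc b ∷ rest)) c₂ b (rest ++ suc c₁ ∷ []) refl)

cutEar-offset≥3 : ∀ c₁ c₂ u v a b post → QC (c₁ ∷ c₂ ∷ u ++ v) → OrbitEarCuttable (c₁ ∷ c₂ ∷ u ++ v) →
                  v ++ suc c₁ ∷ 1 ∷ suc c₂ ∷ u ≡ suc a ∷ 1 ∷ suc b ∷ post → QC (a ∷ b ∷ post)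
cutEar-offset≥3 c₁ c₂ u [] a b post q ih refl = subst (λ z → QC (c₁ ∷ c₂ ∷ z)) (++-identityʳ u) q
cutEar-offset≥3 c₁ c₂ u (v₁ ∷ []) a b post q ih refl = ⊥-elim (QC-head≢0 q (0<length-++-∷ u v₁ []))
cutEar-offset≥3 zero c₂ u (_ ∷ _ ∷ []) a b post q ih refl =
  ⊥-elim (QC-head≢0 q (0<length-++-∷ u (suc a) (1 ∷ [])))
cutEar-offset≥3 (suc c₁) c₂ u (_ ∷ _ ∷ []) a b post q ih refl =
  QC-insertEar (a ∷ []) c₁ c₂ u
    (ih (suc a ∷ 1 ∷ suc c₁ ∷ c₂ ∷ u) (Dih-swap (suc c₁ ∷ c₂ ∷ u) (suc a ∷ 1 ∷ [])) a c₁ (c₂ ∷ u) refl)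
cutEar-offset≥3 c₁ c₂ u (_ ∷ _ ∷ _ ∷ v) a b post q ih refl =
  QC-insertEar (a ∷ b ∷ v) c₁ c₂ u
    (ih (suc a ∷ 1 ∷ suc b ∷ v ++ c₁ ∷ c₂ ∷ u) (Dih-swap (c₁ ∷ c₂ ∷ u) (suc a ∷ 1 ∷ suc b ∷ v))
        a b (v ++ c₁ ∷ c₂ ∷ u) refl)

cutEar-split : ∀ c₁ c₂ rest → QC (c₁ ∷ c₂ ∷ rest) → OrbitEarCuttable (c₁ ∷ c₂ ∷ rest) →
               ∀ u v → u ++ v ≡ suc c₁ ∷ 1 ∷ suc c₂ ∷ rest → EarCuttable (v ++ u)
cutEar-split c₁ c₂ rest q ih u [] e a b post e′
  with trans (sym (trans (sym (++-identityʳ u)) e)) e′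
... | refl = q
cutEar-split c₁ c₂ rest q ih [] v refl a b post refl =
  subst (λ z → QC (c₁ ∷ c₂ ∷ z)) (sym (++-identityʳ rest)) q
cutEar-split c₁ c₂ rest q ih (_ ∷ []) v refl a b post e = cutEar-offset1 c₁ c₂ rest a b post q e
cutEar-split c₁ c₂ rest q ih (_ ∷ _ ∷ []) v refl a b post e = cutEar-offset2 c₁ c₂ rest a b post q ih e
cutEar-split c₁ c₂ rest q ih (_ ∷ _ ∷ _ ∷ u) v refl a b post e = cutEar-offset≥3 c₁ c₂ u v a b post q ih e

cutEar-rotN : ∀ c₁ c₂ rest → QC (c₁ ∷ c₂ ∷ rest) → OrbitEarCuttable (c₁ ∷ c₂ ∷ rest) →
              ∀ k → EarCuttable (rotN k (suc c₁ ∷ 1 ∷ suc c₂ ∷ rest))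
cutEar-rotN c₁ c₂ rest q ih k with rotN-split k (suc c₁ ∷ 1 ∷ suc c₂ ∷ rest)
... | u , v , c≡ , r≡ = subst EarCuttable (sym r≡) (cutEar-split c₁ c₂ rest q ih u v (sym c≡))

QC⇒OrbitEarCuttable : ∀ {c} → QC c → OrbitEarCuttable c
QC⇒OrbitEarCuttable qc-base d h a b post refl with Dih-length h
... | ()
QC⇒OrbitEarCuttable (qc-step {c₁} {c₂} {rest} q) d (k , inj₁ refl) =
  cutEar-rotN c₁ c₂ rest q (QC⇒OrbitEarCuttable q) k
QC⇒OrbitEarCuttable (qc-step {c₁} {c₂} {rest} q) d (k , inj₂ d≡) a b post refl =
  qc-dih (cutEar-rotN c₁ c₂ rest q (QC⇒OrbitEarCuttable q) (length (reverse post) + k)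
                      b a (reverse post) reversed≡rotN)
         (Dih-trans (Dih-reverse (Dih-refl _)) reversed-tail)
  where
  c = suc c₁ ∷ 1 ∷ suc c₂ ∷ rest
  reversed≡rotN : rotN (length (reverse post) + k) c ≡ suc b ∷ 1 ∷ suc a ∷ reverse post
  reversed≡rotN = begin
    rotN (length (reverse post) + k) c                         ≡⟨ rotN-+ (length (reverse post)) k c ⟨
    rotN (length (reverse post)) (rotN k c)
      ≡⟨ cong (rotN (length (reverse post))) (reverse-involutive (rotN k c)) ⟨
    rotN (length (reverse post)) (reverse (reverse (rotN k c)))
      ≡⟨ cong (rotN (length (reverse post)) ∘ reverse) d≡ ⟨
    rotN (length (reverse post)) (reverse (suc a ∷ 1 ∷ suc b ∷ post))
      ≡⟨ cong (rotN (length (reverse post))) (reverse-++ (suc a ∷ 1 ∷ suc b ∷ []) post) ⟩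
    rotN (length (reverse post)) (reverse post ++ suc b ∷ 1 ∷ suc a ∷ [])
      ≡⟨ rotN-++ (reverse post) (suc b ∷ 1 ∷ suc a ∷ []) ⟩
    suc b ∷ 1 ∷ suc a ∷ reverse post ∎
    where open ≡-Reasoning
  reversed-tail : Dih (reverse (b ∷ a ∷ reverse post)) (a ∷ b ∷ post)
  reversed-tail =
    subst (λ z → Dih z (a ∷ b ∷ post))
      (sym (trans (reverse-++ (b ∷ a ∷ []) (reverse post)) (cong (_++ a ∷ b ∷ []) (reverse-involutive post))))
      (Dih-swap post (a ∷ b ∷ []))
QC⇒OrbitEarCuttable (qc-dih q h) d h′ = QC⇒OrbitEarCuttable q d (Dih-trans h h′)

QC-removeEar : ∀ pre a b post → QC (pre ++ suc a ∷ 1 ∷ suc b ∷ post) → QC (pre ++ a ∷ b ∷ post)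
QC-removeEar pre a b post q =
  qc-dih (QC⇒OrbitEarCuttable q _ (Dih-swap pre (suc a ∷ 1 ∷ suc b ∷ post)) a b (post ++ pre) refl)
         (Dih-swap (a ∷ b ∷ post) pre)

-- ψ and the steps of δ preserve quiddity cycles

ψ-++ : ∀ xs ys → ψ (xs ++ ys) ≡ ψ xs ++ ψ ys
ψ-++ = concatMap-++ (λ x → x + 2 ∷ 1 ∷ [])

∷≡∷ʳ⇒≡rot : ∀ (xs ys : List ℕ) → 1 ∷ xs ≡ ys ++ 1 ∷ [] → xs ≡ rot ys
∷≡∷ʳ⇒≡rot xs []      refl = refl
∷≡∷ʳ⇒≡rot xs (_ ∷ _) refl = refl

ψ-reverse : ∀ s → 1 ∷ ψ (reverse s) ≡ reverse (ψ s) ++ 1 ∷ []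
ψ-reverse []      = refl
ψ-reverse (x ∷ s) = begin
  1 ∷ ψ (reverse (x ∷ s))                       ≡⟨ cong (λ z → 1 ∷ ψ z) (unfold-reverse x s) ⟩
  1 ∷ ψ (reverse s ++ x ∷ [])                   ≡⟨ cong (1 ∷_) (ψ-++ (reverse s) (x ∷ [])) ⟩
  (1 ∷ ψ (reverse s)) ++ x + 2 ∷ 1 ∷ []         ≡⟨ cong (_++ x + 2 ∷ 1 ∷ []) (ψ-reverse s) ⟩
  (reverse (ψ s) ++ 1 ∷ []) ++ x + 2 ∷ 1 ∷ []   ≡⟨ ++-assoc (reverse (ψ s)) (1 ∷ []) (x + 2 ∷ 1 ∷ []) ⟩
  reverse (ψ s) ++ (1 ∷ x + 2 ∷ []) ++ 1 ∷ []   ≡⟨ ++-assoc (reverse (ψ s)) (1 ∷ x + 2 ∷ []) (1 ∷ []) ⟨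
  (reverse (ψ s) ++ 1 ∷ x + 2 ∷ []) ++ 1 ∷ []   ≡⟨ cong (_++ 1 ∷ []) (reverse-++ (x + 2 ∷ 1 ∷ []) (ψ s)) ⟨
  reverse (ψ (x ∷ s)) ++ 1 ∷ []                 ∎
  where open ≡-Reasoning

Dih-ψ-reverse : ∀ s → Dih (ψ s) (ψ (reverse s))
Dih-ψ-reverse s =
  subst (Dih (ψ s)) (sym (∷≡∷ʳ⇒≡rot _ _ (ψ-reverse s))) (Dih-rot (Dih-reverse (Dih-refl (ψ s))))

Dih-ψ : ∀ {c d} → Dih c d → Dih (ψ c) (ψ d)
Dih-ψ {c} (k , inj₁ e) with rotN-split k c
... | u , v , c≡ , r≡ = subst₂ Dih (cong ψ (sym c≡)) (cong ψ (sym (trans e r≡)))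
  (subst₂ Dih (sym (ψ-++ u v)) (sym (ψ-++ v u)) (Dih-swap (ψ u) (ψ v)))
Dih-ψ {c} (k , inj₂ e) with rotN-split k c
... | u , v , c≡ , r≡ =
  Dih-trans (subst₂ Dih (cong ψ (sym c≡)) (sym (ψ-++ v u))
                    (subst (λ z → Dih z (ψ v ++ ψ u)) (sym (ψ-++ u v)) (Dih-swap (ψ u) (ψ v))))
            (subst (Dih (ψ (v ++ u))) (cong ψ (sym (trans e (cong reverse r≡)))) (Dih-ψ-reverse (v ++ u)))

QC-ψ : ∀ {c} → QC c → QC (ψ c)
QC-ψ qc-base = qc-step (qc-step qc-base)
QC-ψ (qc-step {c₁} {c₂} {rest} q) =
  QC-insertEar (suc (c₁ + 2) ∷ 1 ∷ []) 2 (c₂ + 2) (1 ∷ ψ rest)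
    (QC-insertEar [] (c₁ + 2) 1 (c₂ + 2 ∷ 1 ∷ ψ rest) (QC-ψ q))
QC-ψ (qc-dih q h) = qc-dih (QC-ψ q) (Dih-ψ h)

QC-removeInteriorEars : ∀ pre z M w → QC (pre ++ suc z ∷ 1 ∷ ψ M ++ suc w ∷ []) → QC (pre ++ z ∷ M ++ w ∷ [])
QC-removeInteriorEars pre z []      w q = QC-removeEar pre z w [] q
QC-removeInteriorEars pre z (m ∷ M) w q =
  subst QC (++-assoc pre (z ∷ []) (m ∷ M ++ w ∷ []))
    (QC-removeInteriorEars (pre ++ z ∷ []) m M w
      (subst QC (sym (++-assoc pre (z ∷ []) (suc m ∷ 1 ∷ ψ M ++ suc w ∷ [])))
        (QC-removeEar pre z (suc m) (1 ∷ ψ M ++ suc w ∷ [])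
          (subst (λ t → QC (pre ++ suc z ∷ 1 ∷ t ∷ 1 ∷ ψ M ++ suc w ∷ [])) (+-comm m 2) q))))

QC-ψ⁻¹ : ∀ {c} → QC (ψ c) → 2 ≤ length c → QC c
QC-ψ⁻¹ {x ∷ xs} q l with initLast xs
... | []         = ⊥-elim (<-irrefl refl l)
... | M ∷ʳ′ z    = QC-removeInteriorEars [] x M z q₃
  where
  q₀ : QC (x + 2 ∷ 1 ∷ ψ M ++ z + 2 ∷ 1 ∷ [])
  q₀ = subst (λ t → QC (x + 2 ∷ 1 ∷ t)) (ψ-++ M (z ∷ [])) q
  q₁ : QC (z + 2 ∷ 1 ∷ x + 2 ∷ 1 ∷ ψ M)
  q₁ = qc-dih q₀ (Dih-swap (x + 2 ∷ 1 ∷ ψ M) (z + 2 ∷ 1 ∷ []))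
  q₂ : QC (suc z ∷ suc x ∷ 1 ∷ ψ M)
  q₂ = QC-removeEar [] (suc z) (suc x) (1 ∷ ψ M)
         (subst₂ (λ s t → QC (s ∷ 1 ∷ t ∷ 1 ∷ ψ M)) (+-comm z 2) (+-comm x 2) q₁)
  q₃ : QC (suc x ∷ 1 ∷ ψ M ++ suc z ∷ [])
  q₃ = qc-dih q₂ (Dih-swap (suc z ∷ []) (suc x ∷ 1 ∷ ψ M))

CycStep-QC : ∀ {u v} → CycStep u v → QC u → QC v
CycStep-QC (δ-i pre a b post _ _) q = QC-insertEar pre a b post q
CycStep-QC (δ-ii a mid b _ _)     q = QC-insertEarAtEnd a mid b q

CycStep-QC⁻¹ : ∀ {u v} → CycStep u v → QC v → QC u
CycStep-QC⁻¹ (δ-i pre a b post _ _) q = QC-removeEar pre a b post q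
CycStep-QC⁻¹ (δ-ii a mid b _ _)     q =
  qc-dih (QC-removeEar [] b a mid (qc-dih q (Dih-swap (suc a ∷ mid) (suc b ∷ 1 ∷ []))))
         (Dih-swap (b ∷ []) (a ∷ mid))

δSteps-QC : ∀ {u v} → Star δStep u v → QC u → QC v
δSteps-QC ε                    q = q
δSteps-QC ((_ , h , s) ◅ steps) q = δSteps-QC steps (CycStep-QC s (qc-dih q h))

δSteps-QC⁻¹ : ∀ {u v} → Star δStep u v → QC v → QC u
δSteps-QC⁻¹ ε                    q = q
δSteps-QC⁻¹ ((_ , h , s) ◅ steps) q = qc-dih (CycStep-QC⁻¹ s (δSteps-QC⁻¹ steps q)) (Dih-sym h)

-- Block decompositions

-- A block (x , b) is an entry x followed by a 1 exactly when b = true; a list of blocks P spells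
-- out expand P. contract q P deletes these 1s and lowers every entry by the number of 1s next to
-- it, q telling whether a 1 precedes the first block. Read cyclically this is contractCycle P,
-- and δ(expand P) = ψ(contractCycle P) when all entries are big (δRel-expand).

Block : Set
Block = ℕ × Bool

Big : Block → Set
Big (x , _) = 1 < x

oneIf : Bool → List ℕ
oneIf true  = 1 ∷ []
oneIf false = []

noOne : Bool → ℕ
noOne true  = 0
noOne false = 1

expand : List Block → List ℕ
expand []            = []
expand ((x , b) ∷ P) = x ∷ oneIf b ++ expand P

expandInit : List Block → List ℕ
expandInit []                = []
expandInit ((x , b) ∷ [])    = x ∷ []
expandInit ((x , b) ∷ p ∷ P) = x ∷ oneIf b ++ expandInit (p ∷ P)

countOnes : List Block → ℕ
countOnes []                = 0
countOnes ((_ , true) ∷ P)  = suc (countOnes P)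
countOnes ((_ , false) ∷ P) = countOnes P

contractEntry : ℕ → Bool → Bool → ℕ
contractEntry x q b = x + noOne q + noOne b ∸ 2

contract : Bool → List Block → List ℕ
contract q []            = []
contract q ((x , b) ∷ P) = contractEntry x q b ∷ contract b P

lastFlag : Bool → List Block → Bool
lastFlag q []            = q
lastFlag q ((_ , b) ∷ P) = lastFlag b P

contractCycle : List Block → List ℕ
contractCycle P = contract (lastFlag true P) P

expand-++ : ∀ P Q → expand (P ++ Q) ≡ expand P ++ expand Q
expand-++ []            Q = refl
expand-++ ((x , b) ∷ P) Q =
  cong (x ∷_) (trans (cong (oneIf b ++_) (expand-++ P Q)) (sym (++-assoc (oneIf b) (expand P) (expand Q))))

contract-++ : ∀ q P Q → contract q (P ++ Q) ≡ contract q P ++ contract (lastFlag q P) Q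
contract-++ q []            Q = refl
contract-++ q ((x , b) ∷ P) Q = cong (contractEntry x q b ∷_) (contract-++ b P Q)

lastFlag-++ : ∀ q P Q → lastFlag q (P ++ Q) ≡ lastFlag (lastFlag q P) Q
lastFlag-++ q []            Q = refl
lastFlag-++ q ((_ , b) ∷ P) Q = lastFlag-++ b P Q

lastFlag-∷ : ∀ q q′ p P → lastFlag q (p ∷ P) ≡ lastFlag q′ (p ∷ P)
lastFlag-∷ q q′ (_ , b) P = refl

lastFlag-self : ∀ P → lastFlag true P ≡ lastFlag (lastFlag true P) P
lastFlag-self []      = refl
lastFlag-self (p ∷ P) = lastFlag-∷ true (lastFlag true (p ∷ P)) p P

lastFlag-∷ʳ : ∀ q P x b → lastFlag q (P ++ (x , b) ∷ []) ≡ b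
lastFlag-∷ʳ q []            x b = refl
lastFlag-∷ʳ q ((_ , c) ∷ P) x b = lastFlag-∷ʳ c P x b

length-contract : ∀ q P → length (contract q P) ≡ length P
length-contract q []            = refl
length-contract q ((_ , b) ∷ P) = cong suc (length-contract b P)

length-expand : ∀ P → length (expand P) ≡ length P + countOnes P
length-expand []                = refl
length-expand ((_ , true) ∷ P)  = cong suc (trans (cong suc (length-expand P)) (sym (+-suc (length P) (countOnes P))))
length-expand ((_ , false) ∷ P) = cong suc (length-expand P)

countOnes≤length : ∀ P → countOnes P ≤ length P
countOnes≤length []                = z≤n
countOnes≤length ((_ , true) ∷ P)  = s≤s (countOnes≤length P)
countOnes≤length ((_ , false) ∷ P) = m≤n⇒m≤1+n (countOnes≤length P)

length≤length-expand : ∀ P → length P ≤ length (expand P)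
length≤length-expand P = ≤-trans (m≤m+n (length P) (countOnes P)) (≤-reflexive (sym (length-expand P)))

expand≡expandInit++ : ∀ p P → expand (p ∷ P) ≡ expandInit (p ∷ P) ++ oneIf (lastFlag true (p ∷ P))
expand≡expandInit++ (x , b) []      = cong (x ∷_) (++-identityʳ (oneIf b))
expand≡expandInit++ (x , b) (p ∷ P) =
  cong (x ∷_) (trans (cong (oneIf b ++_) (expand≡expandInit++ p P)) (sym (++-assoc (oneIf b) (expandInit (p ∷ P)) _)))

expand≡expandInit∷ʳ1 : ∀ p P → lastFlag true (p ∷ P) ≡ true → expand (p ∷ P) ≡ expandInit (p ∷ P) ++ 1 ∷ []
expand≡expandInit∷ʳ1 p P last = trans (expand≡expandInit++ p P) (cong (λ b → expandInit (p ∷ P) ++ oneIf b) last)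

expandInit-∷ʳ : ∀ P x b → expandInit (P ++ (x , b) ∷ []) ≡ expand P ++ x ∷ []
expandInit-∷ʳ []                x b = refl
expandInit-∷ʳ ((y , c) ∷ [])    x b = cong (y ∷_) (cong (_++ x ∷ []) (sym (++-identityʳ (oneIf c))))
expandInit-∷ʳ ((y , c) ∷ p ∷ P) x b =
  cong (y ∷_) (trans (cong (oneIf c ++_) (expandInit-∷ʳ (p ∷ P) x b)) (sym (++-assoc (oneIf c) (expand (p ∷ P)) (x ∷ []))))

rotBlocks : List Block → List Block
rotBlocks []      = []
rotBlocks (p ∷ P) = P ++ p ∷ []

rotBlocksN : ℕ → List Block → List Block
rotBlocksN zero    P = P
rotBlocksN (suc k) P = rotBlocks (rotBlocksN k P)

-- In the reversed sequence the 1 after an entry is the one that preceded it, so reversal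
-- moves every flag to the following block; pb is the flag of the previous block.
revBlocksOnto : List Block → Bool → List Block → List Block
revBlocksOnto acc pb []            = acc
revBlocksOnto acc pb ((x , b) ∷ P) = revBlocksOnto ((x , pb) ∷ acc) b P

revBlocks : List Block → List Block
revBlocks P = revBlocksOnto [] (lastFlag true P) P

contractCycle-rotBlocks : ∀ P → contractCycle (rotBlocks P) ≡ rot (contractCycle P)
contractCycle-rotBlocks []            = refl
contractCycle-rotBlocks ((x , b) ∷ P) = begin
  contract (lastFlag true (P ++ (x , b) ∷ [])) (P ++ (x , b) ∷ [])
    ≡⟨ cong (λ q → contract q (P ++ (x , b) ∷ [])) (lastFlag-++ true P _) ⟩
  contract b (P ++ (x , b) ∷ [])                                   ≡⟨ contract-++ b P _ ⟩
  contract b P ++ contractEntry x (lastFlag b P) b ∷ []            ∎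
  where open ≡-Reasoning

contractCycle-rotBlocksN : ∀ k P → contractCycle (rotBlocksN k P) ≡ rotN k (contractCycle P)
contractCycle-rotBlocksN zero    P = refl
contractCycle-rotBlocksN (suc k) P =
  trans (contractCycle-rotBlocks (rotBlocksN k P)) (cong rot (contractCycle-rotBlocksN k P))

Dih-expand-rotBlocks : ∀ P → Dih (expand P) (expand (rotBlocks P))
Dih-expand-rotBlocks []            = Dih-refl []
Dih-expand-rotBlocks ((x , b) ∷ P) = subst (Dih (expand ((x , b) ∷ P)))
  (sym (trans (expand-++ P ((x , b) ∷ [])) (cong (λ t → expand P ++ x ∷ t) (++-identityʳ (oneIf b)))))
  (Dih-swap (x ∷ oneIf b) (expand P))

Dih-expand-rotBlocksN : ∀ k P → Dih (expand P) (expand (rotBlocksN k P))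
Dih-expand-rotBlocksN zero    P = Dih-refl _
Dih-expand-rotBlocksN (suc k) P = Dih-trans (Dih-expand-rotBlocksN k P) (Dih-expand-rotBlocks (rotBlocksN k P))

All-rotBlocksN : ∀ {Q : Block → Set} k P → All Q P → All Q (rotBlocksN k P)
All-rotBlocksN zero    P a = a
All-rotBlocksN (suc k) P a with rotBlocksN k P | All-rotBlocksN k P a
... | []    | _      = []
... | _ ∷ R | q ∷ a′ = AllP.++⁺ a′ (q ∷ [])

length-rotBlocksN : ∀ k P → length (rotBlocksN k P) ≡ length P
length-rotBlocksN zero    P = refl
length-rotBlocksN (suc k) P with rotBlocksN k P | length-rotBlocksN k P
... | []    | eq = eq
... | p ∷ R | eq = trans (trans (length-++ R) (+-comm (length R) 1)) eq

expand-revBlocksOnto : ∀ acc pb P →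
  oneIf (lastFlag pb P) ++ expand (revBlocksOnto acc pb P) ≡ reverse (expand P) ++ oneIf pb ++ expand acc
expand-revBlocksOnto acc pb []            = refl
expand-revBlocksOnto acc pb ((x , b) ∷ P) = begin
  oneIf (lastFlag b P) ++ expand (revBlocksOnto ((x , pb) ∷ acc) b P) ≡⟨ expand-revBlocksOnto ((x , pb) ∷ acc) b P ⟩
  reverse (expand P) ++ oneIf b ++ x ∷ rest                          ≡⟨ ++-assoc (reverse (expand P)) (oneIf b) _ ⟨
  (reverse (expand P) ++ oneIf b) ++ x ∷ rest                        ≡⟨ ++-assoc (reverse (expand P) ++ oneIf b) (x ∷ []) _ ⟨
  ((reverse (expand P) ++ oneIf b) ++ x ∷ []) ++ rest                ≡⟨ cong (_++ rest) reverse-block ⟨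
  reverse (expand ((x , b) ∷ P)) ++ rest                             ∎
  where
  open ≡-Reasoning
  rest = oneIf pb ++ expand acc
  reverse-oneIf : ∀ b → reverse (oneIf b) ≡ oneIf b
  reverse-oneIf true  = refl
  reverse-oneIf false = refl
  reverse-block : reverse (x ∷ oneIf b ++ expand P) ≡ (reverse (expand P) ++ oneIf b) ++ x ∷ []
  reverse-block = trans (unfold-reverse x (oneIf b ++ expand P))
    (cong (_++ x ∷ []) (trans (reverse-++ (oneIf b) (expand P)) (cong (reverse (expand P) ++_) (reverse-oneIf b))))

expand-revBlocks : ∀ P → oneIf (lastFlag true P) ++ expand (revBlocks P) ≡ reverse (expand P) ++ oneIf (lastFlag true P)
expand-revBlocks P =
  trans (cong (λ q → oneIf q ++ expand (revBlocks P)) (lastFlag-self P))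
        (trans (expand-revBlocksOnto [] (lastFlag true P) P) (cong (reverse (expand P) ++_) (++-identityʳ _)))

expand-revBlocks-lastFalse : ∀ P → lastFlag true P ≡ false → expand (revBlocks P) ≡ reverse (expand P)
expand-revBlocks-lastFalse P last = begin
  expand (revBlocks P)                               ≡⟨⟩
  oneIf false ++ expand (revBlocks P)                ≡⟨ cong (λ b → oneIf b ++ expand (revBlocks P)) last ⟨
  oneIf (lastFlag true P) ++ expand (revBlocks P)    ≡⟨ expand-revBlocks P ⟩
  reverse (expand P) ++ oneIf (lastFlag true P)      ≡⟨ cong (λ b → reverse (expand P) ++ oneIf b) last ⟩
  reverse (expand P) ++ []                           ≡⟨ ++-identityʳ _ ⟩
  reverse (expand P)                                 ∎
  where open ≡-Reasoning

expand-revBlocks-lastTrue : ∀ P → lastFlag true P ≡ true → 1 ∷ expand (revBlocks P) ≡ reverse (expand P) ++ 1 ∷ []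
expand-revBlocks-lastTrue P last =
  trans (cong (λ b → oneIf b ++ expand (revBlocks P)) (sym last))
        (trans (expand-revBlocks P) (cong (λ b → reverse (expand P) ++ oneIf b) last))

expand-revBlocks≡reverse-1∷expandInit : ∀ p P → lastFlag true (p ∷ P) ≡ true →
  expand (revBlocks (p ∷ P)) ≡ reverse (1 ∷ expandInit (p ∷ P))
expand-revBlocks≡reverse-1∷expandInit p P last = begin
  expand (revBlocks (p ∷ P))         ≡⟨ proj₂ (∷-injective 1∷expand≡) ⟩
  reverse (expandInit (p ∷ P)) ++ 1 ∷ [] ≡⟨ unfold-reverse 1 (expandInit (p ∷ P)) ⟨
  reverse (1 ∷ expandInit (p ∷ P))   ∎
  where
  open ≡-Reasoning
  1∷expand≡ : 1 ∷ expand (revBlocks (p ∷ P)) ≡ 1 ∷ reverse (expandInit (p ∷ P)) ++ 1 ∷ []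
  1∷expand≡ = begin
    1 ∷ expand (revBlocks (p ∷ P))                   ≡⟨ expand-revBlocks-lastTrue (p ∷ P) last ⟩
    reverse (expand (p ∷ P)) ++ 1 ∷ []               ≡⟨ cong (λ t → reverse t ++ 1 ∷ []) (expand≡expandInit∷ʳ1 p P last) ⟩
    reverse (expandInit (p ∷ P) ++ 1 ∷ []) ++ 1 ∷ [] ≡⟨ cong (_++ 1 ∷ []) (reverse-++ (expandInit (p ∷ P)) (1 ∷ [])) ⟩
    1 ∷ reverse (expandInit (p ∷ P)) ++ 1 ∷ []       ∎

contract-revBlocksOnto : ∀ acc pb P →
  contract (lastFlag pb P) (revBlocksOnto acc pb P) ≡ reverse (contract pb P) ++ contract pb acc
contract-revBlocksOnto acc pb []            = refl
contract-revBlocksOnto acc pb ((x , b) ∷ P) = begin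
  contract (lastFlag b P) (revBlocksOnto ((x , pb) ∷ acc) b P)    ≡⟨ contract-revBlocksOnto ((x , pb) ∷ acc) b P ⟩
  reverse (contract b P) ++ contractEntry x b pb ∷ contract pb acc
    ≡⟨ cong (λ t → reverse (contract b P) ++ t ∷ contract pb acc) (entry-comm b pb) ⟩
  reverse (contract b P) ++ contractEntry x pb b ∷ contract pb acc
    ≡⟨ ++-assoc (reverse (contract b P)) (contractEntry x pb b ∷ []) _ ⟨
  (reverse (contract b P) ++ contractEntry x pb b ∷ []) ++ contract pb acc
    ≡⟨ cong (_++ contract pb acc) (unfold-reverse (contractEntry x pb b) (contract b P)) ⟨
  reverse (contract pb ((x , b) ∷ P)) ++ contract pb acc           ∎
  where
  open ≡-Reasoning
  entry-comm : ∀ q b → contractEntry x q b ≡ contractEntry x b q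
  entry-comm q b = cong (_∸ 2) (trans (+-assoc x (noOne q) (noOne b))
    (trans (cong (x +_) (+-comm (noOne q) (noOne b))) (sym (+-assoc x (noOne b) (noOne q)))))

lastFlag-revBlocksOnto : ∀ q q′ p acc pb P → lastFlag q (revBlocksOnto (p ∷ acc) pb P) ≡ lastFlag q′ (p ∷ acc)
lastFlag-revBlocksOnto q q′ p acc pb []            = lastFlag-∷ q q′ p acc
lastFlag-revBlocksOnto q q′ p acc pb ((x , b) ∷ P) =
  trans (lastFlag-revBlocksOnto q pb (x , pb) (p ∷ acc) b P) (lastFlag-∷ pb q′ p acc)

contractCycle-revBlocks : ∀ P → contractCycle (revBlocks P) ≡ reverse (contractCycle P)
contractCycle-revBlocks []            = refl
contractCycle-revBlocks ((x , b) ∷ P) =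
  trans (cong (λ q → contract q (revBlocks ((x , b) ∷ P))) last-revBlocks)
        (trans (contract-revBlocksOnto [] (lastFlag true ((x , b) ∷ P)) ((x , b) ∷ P)) (++-identityʳ _))
  where
  last-revBlocks : lastFlag true (revBlocks ((x , b) ∷ P)) ≡ lastFlag (lastFlag b P) ((x , b) ∷ P)
  last-revBlocks = lastFlag-revBlocksOnto true (lastFlag b P) (x , lastFlag b P) [] b P

Dih-expand-revBlocks : ∀ P → Dih (expand P) (expand (revBlocks P))
Dih-expand-revBlocks P = Dih-trans (Dih-reverse (Dih-refl (expand P))) (shift (lastFlag true P) (expand-revBlocks P))
  where
  shift : ∀ b {xs ys} → oneIf b ++ xs ≡ ys ++ oneIf b → Dih ys xs
  shift true  {xs} {ys} e = subst (Dih ys) (sym (∷≡∷ʳ⇒≡rot xs ys e)) (Dih-rot (Dih-refl ys))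
  shift false {xs} {ys} e = subst (Dih ys) (sym (trans e (++-identityʳ ys))) (Dih-refl ys)

All-Big-revBlocksOnto : ∀ acc pb P → All Big acc → All Big P → All Big (revBlocksOnto acc pb P)
All-Big-revBlocksOnto acc pb []            a _          = a
All-Big-revBlocksOnto acc pb ((x , b) ∷ P) a (bx ∷ big) = All-Big-revBlocksOnto ((x , pb) ∷ acc) b P (bx ∷ a) big

length-revBlocksOnto : ∀ acc pb P → length (revBlocksOnto acc pb P) ≡ length P + length acc
length-revBlocksOnto acc pb []            = refl
length-revBlocksOnto acc pb ((x , b) ∷ P) =
  trans (length-revBlocksOnto ((x , pb) ∷ acc) b P) (+-suc (length P) (length acc))

contractCycle-Dih : ∀ P s → Dih (contractCycle P) s →
  ∃ λ P′ → s ≡ contractCycle P′ × Dih (expand P) (expand P′) × (All Big P → All Big P′) × length P′ ≡ length P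
contractCycle-Dih P s (k , inj₁ e) =
  rotBlocksN k P , trans e (sym (contractCycle-rotBlocksN k P)) , Dih-expand-rotBlocksN k P ,
  All-rotBlocksN k P , length-rotBlocksN k P
contractCycle-Dih P s (k , inj₂ e) =
  revBlocks R ,
  trans e (sym (trans (contractCycle-revBlocks R) (cong reverse (contractCycle-rotBlocksN k P)))) ,
  Dih-trans (Dih-expand-rotBlocksN k P) (Dih-expand-revBlocks R) ,
  (λ big → All-Big-revBlocksOnto [] _ R [] (All-rotBlocksN k P big)) ,
  trans (trans (length-revBlocksOnto [] _ R) (+-identityʳ _)) (length-rotBlocksN k P)
  where R = rotBlocksN k P

rotN-expand : ∀ k P → ∃ λ j →
    rotN k (expand P) ≡ expand (rotBlocksN j P)
  ⊎ (rotN k (expand P) ≡ 1 ∷ expandInit (rotBlocksN j P)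
     × ∃ λ p → ∃ λ Q → rotBlocksN j P ≡ p ∷ Q × lastFlag true (p ∷ Q) ≡ true)
rotN-expand zero    P = 0 , inj₁ refl
rotN-expand (suc k) P with rotN-expand k P
... | j , inj₁ e with rotBlocksN j P in eP
...   | [] = suc j , inj₁ (trans (cong rot e) (cong (expand ∘ rotBlocks) (sym eP)))
...   | (x , false) ∷ Q =
  suc j , inj₁ (trans (cong rot e) (trans (sym (expand-++ Q ((x , false) ∷ []))) (cong (expand ∘ rotBlocks) (sym eP))))
...   | (x , true) ∷ [] =
  suc j , inj₂ (trans (cong rot e) (cong (λ z → 1 ∷ expandInit (rotBlocks z)) (sym eP)) ,
                (x , true) , [] , cong rotBlocks eP , refl)
...   | (x , true) ∷ q ∷ Q =
  suc j , inj₂ (trans (cong rot e)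
                      (cong (1 ∷_) (trans (sym (expandInit-∷ʳ (q ∷ Q) x true)) (cong (expandInit ∘ rotBlocks) (sym eP)))) ,
                q , Q ++ (x , true) ∷ [] , cong rotBlocks eP , lastFlag-∷ʳ true (q ∷ Q) x true)
rotN-expand (suc k) P | j , inj₂ (e , p , Q , eP , last) = j , inj₁ (begin
  rot (rotN k (expand P))               ≡⟨ cong rot e ⟩
  rot (1 ∷ expandInit (rotBlocksN j P)) ≡⟨ cong (λ R → expandInit R ++ 1 ∷ []) eP ⟩
  expandInit (p ∷ Q) ++ 1 ∷ []          ≡⟨ expand≡expandInit∷ʳ1 p Q last ⟨
  expand (p ∷ Q)                        ≡⟨ cong expand eP ⟨
  expand (rotBlocksN j P)               ∎)
  where open ≡-Reasoning

Dih-contractCycle-rotBlocksN : ∀ j P → Dih (contractCycle P) (contractCycle (rotBlocksN j P))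
Dih-contractCycle-rotBlocksN j P = subst (Dih _) (sym (contractCycle-rotBlocksN j P)) (j , inj₁ refl)

Dih-contractCycle-revBlocks : ∀ j P → Dih (contractCycle P) (contractCycle (revBlocks (rotBlocksN j P)))
Dih-contractCycle-revBlocks j P =
  subst (Dih _) (sym (trans (contractCycle-revBlocks (rotBlocksN j P)) (cong reverse (contractCycle-rotBlocksN j P))))
        (j , inj₂ refl)

All-Big-revBlocks : ∀ j P → All Big P → All Big (revBlocks (rotBlocksN j P))
All-Big-revBlocks j P big = All-Big-revBlocksOnto [] _ (rotBlocksN j P) [] (All-rotBlocksN j P big)

expand-Dih : ∀ P y r → Dih (expand P) (y ∷ r) → 1 < y →
  ∃ λ P′ → y ∷ r ≡ expand P′ × Dih (contractCycle P) (contractCycle P′) × (All Big P → All Big P′)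
expand-Dih P y r (k , inj₁ e) big with rotN-expand k P
... | j , inj₁ e′ = rotBlocksN j P , trans e e′ , Dih-contractCycle-rotBlocksN j P , All-rotBlocksN j P
... | j , inj₂ (e′ , _) with trans e e′
...   | refl = ⊥-elim (<-irrefl refl big)
expand-Dih P y r (k , inj₂ e) big with rotN-expand k P
... | j , inj₁ e′ with lastFlag true (rotBlocksN j P) in last
...   | false =
  revBlocks (rotBlocksN j P) ,
  trans e (trans (cong reverse e′) (sym (expand-revBlocks-lastFalse (rotBlocksN j P) last))) ,
  Dih-contractCycle-revBlocks j P , All-Big-revBlocks j P
...   | true = ⊥-elim (<-irrefl (proj₁ (∷-injective 1∷≡y∷)) big)
  where
  1∷≡y∷ : 1 ∷ expand (revBlocks (rotBlocksN j P)) ≡ (y ∷ r) ++ 1 ∷ []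
  1∷≡y∷ = trans (expand-revBlocks-lastTrue (rotBlocksN j P) last)
                (cong (_++ 1 ∷ []) (trans (cong reverse (sym e′)) (sym e)))
expand-Dih P y r (k , inj₂ e) big | j , inj₂ (e′ , p , Q , eP , last) =
  revBlocks (rotBlocksN j P) ,
  trans e (trans (cong reverse e′) (sym reversed)) ,
  Dih-contractCycle-revBlocks j P , All-Big-revBlocks j P
  where
  reversed : expand (revBlocks (rotBlocksN j P)) ≡ reverse (1 ∷ expandInit (rotBlocksN j P))
  reversed = subst (λ R → expand (revBlocks R) ≡ reverse (1 ∷ expandInit R)) (sym eP)
                   (expand-revBlocks≡reverse-1∷expandInit p Q last)

-- Quiddity cycles of length at least 4 are expansions

QC-no11-front : ∀ {s} → QC (1 ∷ 1 ∷ s) → 2 ≤ length s → ⊥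
QC-no11-front {zero ∷ _} q _ with QC-positive q (s≤s (s≤s (s≤s z≤n)))
... | _ ∷ _ ∷ () ∷ _
QC-no11-front {suc s ∷ rest} q l = QC-head≢0 (QC-removeEar [] 0 s rest q) (s≤s⁻¹ l)

No11 : List ℕ → Set
No11 r = ∀ pre post → r ≡ pre ++ 1 ∷ 1 ∷ post → ⊥

QC⇒No11 : ∀ {d} → QC d → 4 ≤ length d → No11 d
QC⇒No11 q l pre post refl =
  QC-no11-front (qc-dih q swap) (s≤s⁻¹ (s≤s⁻¹ (≤-trans l (≤-reflexive (sym (Dih-length swap))))))
  where swap = Dih-swap pre (1 ∷ 1 ∷ post)

parseBlocks : ∀ x r → 1 < x → All (0 <_) r → No11 (x ∷ r) → ∃ λ P → x ∷ r ≡ expand P × All Big P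
parseBlocks x []                   big _ _ = (x , false) ∷ [] , refl , big ∷ []
parseBlocks x (1 ∷ [])             big _ _ = (x , true) ∷ [] , refl , big ∷ []
parseBlocks x (1 ∷ 0 ∷ r)          big (_ ∷ () ∷ _) _
parseBlocks x (1 ∷ 1 ∷ r)          big _ no11 = ⊥-elim (no11 (x ∷ []) r refl)
parseBlocks x (1 ∷ suc (suc y) ∷ r) big (_ ∷ _ ∷ pos) no11
  with parseBlocks (suc (suc y)) r (s≤s (s≤s z≤n)) pos (λ pre post e → no11 (x ∷ 1 ∷ pre) post (cong (λ z → x ∷ 1 ∷ z) e))
... | P , e , bigP = (x , true) ∷ P , cong (λ z → x ∷ 1 ∷ z) e , big ∷ bigP
parseBlocks x (0 ∷ r)              big (() ∷ _) _
parseBlocks x (suc (suc y) ∷ r)    big (_ ∷ pos) no11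
  with parseBlocks (suc (suc y)) r (s≤s (s≤s z≤n)) pos (λ pre post e → no11 (x ∷ pre) post (cong (x ∷_) e))
... | P , e , bigP = (x , false) ∷ P , cong (x ∷_) e , big ∷ bigP

length-expand≤ : ∀ P → length (expand P) ≤ 2 * length P
length-expand≤ P = begin
  length (expand P)          ≡⟨ length-expand P ⟩
  length P + countOnes P     ≤⟨ +-monoʳ-≤ (length P) (countOnes≤length P) ⟩
  length P + length P        ≡⟨ cong (length P +_) (+-identityʳ (length P)) ⟨
  2 * length P               ∎
  where open ≤-Reasoning

QC-blocks-bigHead : ∀ {x r} → QC (x ∷ r) → 4 ≤ length (x ∷ r) → 1 < x →
                    ∃ λ P → x ∷ r ≡ expand P × All Big P × 2 ≤ length P
QC-blocks-bigHead {x} {r} q l big with QC-positive q (≤-trans (s≤s (s≤s (s≤s z≤n))) l)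
... | _ ∷ pos with parseBlocks x r big pos (QC⇒No11 q l)
... | P , e , bigP = P , e , bigP , *-cancelˡ-≤ 2 (≤-trans l (≤-trans (≤-reflexive (cong length e)) (length-expand≤ P)))

QC-blocks : ∀ c → QC c → 4 ≤ length c → ∃ λ P → Dih c (expand P) × All Big P × 2 ≤ length P
QC-blocks [] q ()
QC-blocks (0 ∷ r) q l with QC-positive q (≤-trans (s≤s (s≤s (s≤s z≤n))) l)
... | () ∷ _
QC-blocks (suc (suc x) ∷ r) q l with QC-blocks-bigHead q l (s≤s (s≤s z≤n))
... | P , e , bigP , lP = P , subst (Dih _) e (Dih-refl _) , bigP , lP
QC-blocks (1 ∷ []) q (s≤s ())
QC-blocks (1 ∷ 0 ∷ r) q l with QC-positive q (≤-trans (s≤s (s≤s (s≤s z≤n))) l)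
... | _ ∷ () ∷ _
QC-blocks (1 ∷ 1 ∷ r) q l = ⊥-elim (QC⇒No11 q l [] r refl)
QC-blocks (1 ∷ suc (suc y) ∷ r) q l
  with QC-blocks-bigHead (qc-dih q swap) (≤-trans l (≤-reflexive (sym (Dih-length swap)))) (s≤s (s≤s z≤n))
  where swap = Dih-swap (1 ∷ []) (suc (suc y) ∷ r)
... | P , e , bigP , lP = P , subst (Dih _) e (Dih-swap (1 ∷ []) (suc (suc y) ∷ r)) , bigP , lP

-- δ and ρ on expansions

EarInsertion : (List ℕ → List ℕ → Set) → Set
EarInsertion R = ∀ pre a b post → 1 < a → 1 < b → R (pre ++ a ∷ b ∷ post) (pre ++ suc a ∷ 1 ∷ suc b ∷ post)

δ-earInsertion : EarInsertion δStep
δ-earInsertion pre a b post big-a big-b = _ , Dih-refl _ , δ-i pre a b post big-a big-b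

-- The flag q tells whether a 1 precedes the first block; if not, the first entry has
-- already been raised by an ear inserted in front of it.
expandAfter : Bool → List Block → List ℕ
expandAfter q []            = []
expandAfter q ((x , b) ∷ P) = noOne q + x ∷ oneIf b ++ expand P

fillInterior : Bool → List Block → List ℕ
fillInterior q []                = []
fillInterior q ((x , b) ∷ [])    = noOne q + x ∷ oneIf b ++ []
fillInterior q ((x , b) ∷ p ∷ P) = noOne b + (noOne q + x) ∷ 1 ∷ fillInterior b (p ∷ P)

fillAll : Bool → List Block → List ℕ
fillAll q []            = []
fillAll q ((x , b) ∷ P) = noOne b + (noOne q + x) ∷ 1 ∷ fillAll b P

big-+ : ∀ {x} k → 1 < x → 1 < k + x
big-+ {x} k big = ≤-trans big (m≤n+m x k)

fillInterior-steps : ∀ {R} → EarInsertion R → ∀ pre q P → All Big P →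
                     Star R (pre ++ expandAfter q P) (pre ++ fillInterior q P)
fillInterior-steps ins pre q []                      _ = ε
fillInterior-steps ins pre q ((x , b) ∷ [])          _ = ε
fillInterior-steps ins pre q ((x , true) ∷ (y , c) ∷ P) (_ ∷ big) =
  subst₂ (Star _) (++-assoc pre (noOne q + x ∷ 1 ∷ []) _) (++-assoc pre (noOne q + x ∷ 1 ∷ []) _)
    (fillInterior-steps ins (pre ++ noOne q + x ∷ 1 ∷ []) true ((y , c) ∷ P) big)
fillInterior-steps ins pre q ((x , false) ∷ (y , c) ∷ P) (big-x ∷ big-y ∷ big) =
  ins pre (noOne q + x) y (oneIf c ++ expand P) (big-+ (noOne q) big-x) big-y ◅
  subst₂ (Star _) (++-assoc pre (suc (noOne q + x) ∷ 1 ∷ []) _) (++-assoc pre (suc (noOne q + x) ∷ 1 ∷ []) _)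
    (fillInterior-steps ins (pre ++ suc (noOne q + x) ∷ 1 ∷ []) false ((y , c) ∷ P) (big-y ∷ big))

fillInterior≡fillAll : ∀ q P → lastFlag q P ≡ true → fillInterior q P ≡ fillAll q P
fillInterior≡fillAll q []                 _    = refl
fillInterior≡fillAll q ((x , true) ∷ [])  _    = refl
fillInterior≡fillAll q ((x , b) ∷ p ∷ P)  last = cong (λ t → _ ∷ 1 ∷ t) (fillInterior≡fillAll b (p ∷ P) last)

fillInterior-lastGap : ∀ q p P → lastFlag q (p ∷ P) ≡ false → All Big (p ∷ P) →
  ∃ λ mid → ∃ λ z → fillInterior q (p ∷ P) ≡ mid ++ z ∷ [] × fillAll q (p ∷ P) ≡ mid ++ suc z ∷ 1 ∷ [] × 1 < z
fillInterior-lastGap q (x , false) [] _ (big ∷ _) = [] , noOne q + x , refl , refl , big-+ (noOne q) big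
fillInterior-lastGap q (x , b) (p ∷ P) last (_ ∷ big) with fillInterior-lastGap b p P last big
... | mid , z , e₁ , e₂ , big-z =
  noOne b + (noOne q + x) ∷ 1 ∷ mid , z , cong (λ t → _ ∷ 1 ∷ t) e₁ , cong (λ t → _ ∷ 1 ∷ t) e₂ , big-z

expandAfter-true : ∀ P → expandAfter true P ≡ expand P
expandAfter-true []      = refl
expandAfter-true (_ ∷ P) = refl

δSteps-expand : ∀ P → All Big P → 2 ≤ length P → Star δStep (expand P) (fillAll (lastFlag true P) P)
δSteps-expand P big l with lastFlag true P in last
... | true = subst₂ (Star δStep) (expandAfter-true P) (fillInterior≡fillAll true P last)
                    (fillInterior-steps δ-earInsertion [] true P big)
δSteps-expand ((x , b) ∷ []) _ (s≤s ()) | false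
δSteps-expand ((x , b) ∷ p ∷ P) (big-x ∷ big) l | false with fillInterior-lastGap b p P last big
... | mid , z , e₁ , e₂ , big-z =
  fillInterior-steps δ-earInsertion [] true ((x , b) ∷ p ∷ P) (big-x ∷ big) ◅◅
  (subst₂ δStep (cong (λ t → noOne b + x ∷ 1 ∷ t) (sym e₁)) (cong₂ (λ s t → s ∷ 1 ∷ t) (sym (+-suc (noOne b) x)) (sym e₂))
     (_ , Dih-refl _ , δ-ii (noOne b + x) (1 ∷ mid) z (big-+ (noOne b) big-x) big-z)) ◅ ε

ρSteps-fillInterior : ∀ p q Q → All Big (q ∷ Q) → Star ρStep (oneIf p ++ expand (q ∷ Q)) (1 ∷ fillInterior p (q ∷ Q))
ρSteps-fillInterior true  q       Q big = fillInterior-steps ρ-i (1 ∷ []) true (q ∷ Q) big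
ρSteps-fillInterior false (x , b) Q (big-x ∷ big) =
  ρ-ii x (oneIf b ++ expand Q) big-x ◅ fillInterior-steps ρ-i (1 ∷ []) false ((x , b) ∷ Q) (big-x ∷ big)

ρSteps-expand : ∀ p q Q → All Big (q ∷ Q) → Star ρStep (oneIf p ++ expand (q ∷ Q)) (1 ∷ fillAll p (q ∷ Q))
ρSteps-expand p q Q big with lastFlag p (q ∷ Q) in last
... | true = subst (λ z → Star ρStep (oneIf p ++ expand (q ∷ Q)) (1 ∷ z)) (fillInterior≡fillAll p (q ∷ Q) last)
                   (ρSteps-fillInterior p q Q big)
... | false with fillInterior-lastGap p q Q last big
...   | mid , z , e₁ , e₂ , big-z =
  subst (Star ρStep _) (cong (1 ∷_) e₁) (ρSteps-fillInterior p q Q big) ◅◅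
  (subst (ρStep (1 ∷ mid ++ z ∷ [])) (cong (1 ∷_) (sym e₂)) (ρ-iii (1 ∷ mid) z big-z) ◅ ε)

contractEntry+2 : ∀ x q b → 1 < x → contractEntry x q b + 2 ≡ noOne b + (noOne q + x)
contractEntry+2 x q b big =
  trans (m∸n+n≡m (≤-trans big (≤-trans (m≤m+n x (noOne q)) (m≤m+n (x + noOne q) (noOne b)))))
        (trans (+-comm (x + noOne q) (noOne b)) (cong (noOne b +_) (+-comm x (noOne q))))

fillAll≡ψ : ∀ q P → All Big P → fillAll q P ≡ ψ (contract q P)
fillAll≡ψ q []            _           = refl
fillAll≡ψ q ((x , b) ∷ P) (big ∷ bigP) =
  cong₂ (λ s t → s ∷ 1 ∷ t) (sym (contractEntry+2 x q b big)) (fillAll≡ψ b P bigP)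

NoBigPair : List ℕ → Set
NoBigPair []          = ⊤
NoBigPair (a ∷ [])    = ⊤
NoBigPair (a ∷ b ∷ r) = ¬ (1 < a × 1 < b) × NoBigPair (b ∷ r)

NoBigPair⇒¬split : ∀ pre a b post → NoBigPair (pre ++ a ∷ b ∷ post) → 1 < a → 1 < b → ⊥
NoBigPair⇒¬split []                 a b post (nbp , _) big-a big-b = nbp (big-a , big-b)
NoBigPair⇒¬split (_ ∷ [])           a b post (_ , nbp) big-a big-b = NoBigPair⇒¬split [] a b post nbp big-a big-b
NoBigPair⇒¬split (_ ∷ x ∷ pre)      a b post (_ , nbp) big-a big-b = NoBigPair⇒¬split (x ∷ pre) a b post nbp big-a big-b

NoBigPair-1∷ : ∀ l → NoBigPair l → NoBigPair (1 ∷ l)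
NoBigPair-1∷ []      _  = tt
NoBigPair-1∷ (_ ∷ l) nbp = (λ { (s≤s () , _) }) , nbp

AllFlagged : List Block → Set
AllFlagged = All (λ p → proj₂ p ≡ true)

NoBigPair-expand : ∀ P → AllFlagged P → NoBigPair (expand P)
NoBigPair-expand []               _          = tt
NoBigPair-expand ((x , true) ∷ P) (_ ∷ flag) = (λ { (_ , s≤s ()) }) , NoBigPair-1∷ (expand P) (NoBigPair-expand P flag)

NoBigPair-expandInit : ∀ P → AllFlagged P → NoBigPair (expandInit P)
NoBigPair-expandInit []                   _          = tt
NoBigPair-expandInit ((x , b) ∷ [])       _          = tt
NoBigPair-expandInit ((x , true) ∷ p ∷ P) (_ ∷ flag) =
  (λ { (_ , s≤s ()) }) , NoBigPair-1∷ (expandInit (p ∷ P)) (NoBigPair-expandInit (p ∷ P) flag)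

lastFlag-flagged : ∀ P → AllFlagged P → lastFlag true P ≡ true
lastFlag-flagged []               _          = refl
lastFlag-flagged ((x , true) ∷ P) (_ ∷ flag) = lastFlag-flagged P flag

AllFlagged-revBlocksOnto : ∀ acc pb P → AllFlagged acc → pb ≡ true → AllFlagged P → AllFlagged (revBlocksOnto acc pb P)
AllFlagged-revBlocksOnto acc pb []            flag _    _            = flag
AllFlagged-revBlocksOnto acc pb ((x , b) ∷ P) flag refl (refl ∷ flagP) =
  AllFlagged-revBlocksOnto ((x , pb) ∷ acc) b P (refl ∷ flag) refl flagP

AllFlagged-revBlocks : ∀ P → AllFlagged P → AllFlagged (revBlocks P)
AllFlagged-revBlocks P flag = AllFlagged-revBlocksOnto [] _ P [] (lastFlag-flagged P flag) flag

reverse-expand-flagged : ∀ p P → AllFlagged (p ∷ P) → reverse (expand (p ∷ P)) ≡ 1 ∷ expandInit (revBlocks (p ∷ P))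
reverse-expand-flagged p P flag with revBlocks (p ∷ P) in eq | AllFlagged-revBlocks (p ∷ P) flag
... | [] | _ with () ← trans (sym (+-identityʳ _)) (trans (sym (length-revBlocksOnto [] _ (p ∷ P))) (cong length eq))
... | p′ ∷ P′ | flag′ = sym (∷ʳ-injectiveˡ (1 ∷ expandInit (p′ ∷ P′)) (reverse (expand (p ∷ P))) (begin
  1 ∷ expandInit (p′ ∷ P′) ++ 1 ∷ []      ≡⟨ cong (1 ∷_) (expand≡expandInit∷ʳ1 p′ P′ (lastFlag-flagged (p′ ∷ P′) flag′)) ⟨
  1 ∷ expand (p′ ∷ P′)                    ≡⟨ cong (λ R → 1 ∷ expand R) eq ⟨
  1 ∷ expand (revBlocks (p ∷ P))          ≡⟨ expand-revBlocks-lastTrue (p ∷ P) (lastFlag-flagged (p ∷ P) flag) ⟩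
  reverse (expand (p ∷ P)) ++ 1 ∷ []      ∎))
  where open ≡-Reasoning

FlaggedShape : List ℕ → Set
FlaggedShape r = ∃ λ P → AllFlagged P × (r ≡ expand P ⊎ r ≡ 1 ∷ expandInit P)

Dih-expand-flagged : ∀ P r → AllFlagged P → Dih (expand P) r → FlaggedShape r
Dih-expand-flagged P r flag (k , inj₁ e) with rotN-expand k P
... | j , inj₁ e′       = rotBlocksN j P , All-rotBlocksN j P flag , inj₁ (trans e e′)
... | j , inj₂ (e′ , _) = rotBlocksN j P , All-rotBlocksN j P flag , inj₂ (trans e e′)
Dih-expand-flagged P r flag (k , inj₂ e) with rotN-expand k P
... | j , inj₁ e′ with rotBlocksN j P | All-rotBlocksN j P flag
...   | []    | _     = [] , [] , inj₁ (trans e (cong reverse e′))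
...   | p ∷ R | flagR =
  revBlocks (p ∷ R) , AllFlagged-revBlocks (p ∷ R) flagR ,
  inj₂ (trans e (trans (cong reverse e′) (reverse-expand-flagged p R flagR)))
Dih-expand-flagged P r flag (k , inj₂ e) | j , inj₂ (e′ , p , Q , eP , last) =
  revBlocks (rotBlocksN j P) , AllFlagged-revBlocks _ (All-rotBlocksN j P flag) ,
  inj₁ (trans e (trans (cong reverse e′) (sym reversed)))
  where
  reversed : expand (revBlocks (rotBlocksN j P)) ≡ reverse (1 ∷ expandInit (rotBlocksN j P))
  reversed = subst (λ R → expand (revBlocks R) ≡ reverse (1 ∷ expandInit R)) (sym eP)
                   (expand-revBlocks≡reverse-1∷expandInit p Q last)

FlaggedShape⇒¬CycStep : ∀ {r h} → FlaggedShape r → ¬ CycStep r h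
FlaggedShape⇒¬CycStep (P , flag , inj₁ e) (δ-i pre a b post big-a big-b) =
  NoBigPair⇒¬split pre a b post (subst NoBigPair (sym e) (NoBigPair-expand P flag)) big-a big-b
FlaggedShape⇒¬CycStep (P , flag , inj₂ e) (δ-i pre a b post big-a big-b) =
  NoBigPair⇒¬split pre a b post (subst NoBigPair (sym e) (NoBigPair-1∷ _ (NoBigPair-expandInit P flag))) big-a big-b
FlaggedShape⇒¬CycStep ([] , _ , inj₁ ()) (δ-ii a mid b _ _)
FlaggedShape⇒¬CycStep (p ∷ P , flag , inj₁ e) (δ-ii a mid b _ big-b)
  with ∷ʳ-injectiveʳ (a ∷ mid) (expandInit (p ∷ P))
         (trans e (expand≡expandInit∷ʳ1 p P (lastFlag-flagged (p ∷ P) flag)))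
... | refl with big-b
...   | s≤s ()
FlaggedShape⇒¬CycStep (P , flag , inj₂ e) (δ-ii a mid b big-a _) = <-irrefl (sym (proj₁ (∷-injective e))) big-a

ψBlocks : List ℕ → List Block
ψBlocks []      = []
ψBlocks (y ∷ c) = (y + 2 , true) ∷ ψBlocks c

ψ≡expand-ψBlocks : ∀ c → ψ c ≡ expand (ψBlocks c)
ψ≡expand-ψBlocks []      = refl
ψ≡expand-ψBlocks (y ∷ c) = cong (λ t → y + 2 ∷ 1 ∷ t) (ψ≡expand-ψBlocks c)

AllFlagged-ψBlocks : ∀ c → AllFlagged (ψBlocks c)
AllFlagged-ψBlocks []      = []
AllFlagged-ψBlocks (y ∷ c) = refl ∷ AllFlagged-ψBlocks c

ψ-δNormal : ∀ c h → ¬ δStep (ψ c) h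
ψ-δNormal c h (r , ψc~r , step) =
  FlaggedShape⇒¬CycStep
    (Dih-expand-flagged (ψBlocks c) r (AllFlagged-ψBlocks c) (subst (λ z → Dih z r) (ψ≡expand-ψBlocks c) ψc~r)) step

ιψ-ρNormal : ∀ c h → ¬ ρStep (ι (ψ c)) h
ιψ-ρNormal c h step = go step refl
  where
  ends-with-1 : ∀ c → ∃ λ w → 1 ∷ ψ c ≡ w ++ 1 ∷ []
  ends-with-1 []      = [] , refl
  ends-with-1 (y ∷ c) with ends-with-1 c
  ... | w , e = 1 ∷ y + 2 ∷ w , cong (λ z → 1 ∷ y + 2 ∷ z) e
  go : ∀ {t} → ρStep t h → t ≡ ι (ψ c) → ⊥
  go (ρ-i pre a b post big-a big-b) e =
    NoBigPair⇒¬split pre a b post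
      (subst NoBigPair (sym (trans e (cong (1 ∷_) (ψ≡expand-ψBlocks c))))
             (NoBigPair-1∷ _ (NoBigPair-expand (ψBlocks c) (AllFlagged-ψBlocks c)))) big-a big-b
  go (ρ-ii a rest big) e = <-irrefl (sym (proj₁ (∷-injective e))) big
  go (ρ-iii rest a big) e with ends-with-1 c
  ... | w , e′ = <-irrefl (sym (∷ʳ-injectiveʳ rest w (trans e e′))) big

δRel-expand : ∀ P → All Big P → 2 ≤ length P → δRel (expand P) (ψ (contractCycle P))
δRel-expand P big l = subst (Star δStep (expand P)) (fillAll≡ψ (lastFlag true P) P big) (δSteps-expand P big l) ,
                      ψ-δNormal (contractCycle P)

ρRel-expand : ∀ p q Q → All Big (q ∷ Q) → ρRel (oneIf p ++ expand (q ∷ Q)) (ι (ψ (contract p (q ∷ Q))))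
ρRel-expand p q Q big = subst (Star ρStep _) (cong (1 ∷_) (fillAll≡ψ p (q ∷ Q) big)) (ρSteps-expand p q Q big) ,
                        ιψ-ρNormal (contract p (q ∷ Q))

-- Preimages under δ and ρ

contractEntry-dropEarʳ : ∀ x q → contractEntry (suc x) q true ≡ contractEntry x q false
contractEntry-dropEarʳ x q = cong (_∸ 2) (regroup x (noOne q))
  where
  regroup : ∀ x n → suc x + n + 0 ≡ x + n + 1
  regroup = solve-∀

contractEntry-dropEarˡ : ∀ x b → contractEntry (suc x) true b ≡ contractEntry x false b
contractEntry-dropEarˡ x b = cong (_∸ 2) (regroup x (noOne b))
  where
  regroup : ∀ x n → suc x + 0 + n ≡ x + 1 + n
  regroup = solve-∀

contract-dropEar : ∀ q P a b β Q →
  contract q (P ++ (suc a , true) ∷ (suc b , β) ∷ Q) ≡ contract q (P ++ (a , false) ∷ (b , β) ∷ Q)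
contract-dropEar q P a b β Q =
  trans (contract-++ q P _)
        (trans (cong (contract q P ++_)
                     (cong₂ _∷_ (contractEntry-dropEarʳ a (lastFlag q P))
                                (cong (_∷ contract β Q) (contractEntry-dropEarˡ b β))))
               (sym (contract-++ q P _)))

contract-dropLastEar : ∀ q P a → contract q (P ++ (suc a , true) ∷ []) ≡ contract q (P ++ (a , false) ∷ [])
contract-dropLastEar q P a =
  trans (contract-++ q P _)
        (trans (cong (λ t → contract q P ++ t ∷ []) (contractEntry-dropEarʳ a (lastFlag q P))) (sym (contract-++ q P _)))

[]≢++∷ : ∀ (pre : List ℕ) {x w} → [] ≡ pre ++ x ∷ w → ⊥
[]≢++∷ []      ()
[]≢++∷ (_ ∷ _) ()

expand-split : ∀ pre x rest P → All Big P → 1 < x → expand P ≡ pre ++ x ∷ 1 ∷ rest →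
  ∃ λ P₁ → ∃ λ P₂ → P ≡ P₁ ++ (x , true) ∷ P₂ × expand P₁ ≡ pre × expand P₂ ≡ rest
expand-split pre x rest [] _ _ e = ⊥-elim ([]≢++∷ pre e)
expand-split [] x rest ((y , true) ∷ P) _ _ e with ∷-injective e
... | refl , e′ = [] , P , refl , refl , proj₂ (∷-injective e′)
expand-split [] x rest ((y , false) ∷ []) _ _ ()
expand-split [] x rest ((y , false) ∷ (z , _) ∷ P) (_ ∷ big-z ∷ _) _ e =
  ⊥-elim (<-irrefl (sym (proj₁ (∷-injective (proj₂ (∷-injective e))))) big-z)
expand-split (z ∷ pre) x rest ((y , false) ∷ P) (_ ∷ big) big-x e with ∷-injective e
... | refl , e′ with expand-split pre x rest P big big-x e′
... | P₁ , P₂ , refl , e₁ , e₂ = (y , false) ∷ P₁ , P₂ , refl , cong (y ∷_) e₁ , e₂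
expand-split (z ∷ []) x rest ((y , true) ∷ P) _ big-x e =
  ⊥-elim (<-irrefl (proj₁ (∷-injective (proj₂ (∷-injective e)))) big-x)
expand-split (z ∷ w ∷ pre) x rest ((y , true) ∷ P) (_ ∷ big) big-x e with ∷-injective e
... | refl , e′ with ∷-injective e′
... | refl , e″ with expand-split pre x rest P big big-x e″
... | P₁ , P₂ , refl , e₁ , e₂ = (y , true) ∷ P₁ , P₂ , refl , cong (λ t → y ∷ 1 ∷ t) e₁ , e₂

expand-dropEar : ∀ pre a b post P → All Big P → 1 < a → 1 < b → expand P ≡ pre ++ suc a ∷ 1 ∷ suc b ∷ post →
  ∃ λ P′ → All Big P′ × expand P′ ≡ pre ++ a ∷ b ∷ post
         × (∀ q → contract q P′ ≡ contract q P) × contractCycle P′ ≡ contractCycle P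
expand-dropEar pre a b post P big big-a big-b e
  with expand-split pre (suc a) (suc b ∷ post) P big (≤-trans big-a (n≤1+n a)) e
... | P₁ , [] , _ , _ , ()
... | P₁ , (y , β) ∷ P₃ , refl , e₁ , e₃ with ∷-injective e₃
... | refl , e₃′ = P₁ ++ (a , false) ∷ (b , β) ∷ P₃ , big′ , expanded , contracted , contractedCycle
  where
  big′ : All Big (P₁ ++ (a , false) ∷ (b , β) ∷ P₃)
  big′ with AllP.++⁻ P₁ big
  ... | big₁ , _ ∷ _ ∷ big₃ = AllP.++⁺ big₁ (big-a ∷ big-b ∷ big₃)
  expanded : expand (P₁ ++ (a , false) ∷ (b , β) ∷ P₃) ≡ pre ++ a ∷ b ∷ post
  expanded = trans (expand-++ P₁ _) (cong₂ _++_ e₁ (cong (λ t → a ∷ b ∷ t) e₃′))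
  contracted : ∀ q → contract q (P₁ ++ (a , false) ∷ (b , β) ∷ P₃) ≡ contract q (P₁ ++ (suc a , true) ∷ (suc b , β) ∷ P₃)
  contracted q = sym (contract-dropEar q P₁ a b β P₃)
  contractedCycle :
    contractCycle (P₁ ++ (a , false) ∷ (b , β) ∷ P₃) ≡ contractCycle (P₁ ++ (suc a , true) ∷ (suc b , β) ∷ P₃)
  contractedCycle =
    trans (cong (λ q → contract q (P₁ ++ (a , false) ∷ (b , β) ∷ P₃))
                (trans (lastFlag-++ true P₁ _) (sym (lastFlag-++ true P₁ _))))
          (contracted _)

oneIf-++-big : ∀ p X pre y Y → 1 < y → oneIf p ++ X ≡ pre ++ y ∷ Y → ∃ λ pre′ → pre ≡ oneIf p ++ pre′ × X ≡ pre′ ++ y ∷ Y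
oneIf-++-big false X pre       y Y _   e = pre , refl , e
oneIf-++-big true  X []        y Y big e = ⊥-elim (<-irrefl (proj₁ (∷-injective e)) big)
oneIf-++-big true  X (z ∷ pre) y Y _   e with ∷-injective e
... | refl , e′ = pre , refl , e′

-- By ρRel-expand and ρRel-ιψ⁻¹ these are exactly the f with ρ(f) = ι(ψ(h)).
ρPreimage : List ℕ → List ℕ → Set
ρPreimage h u = ∃ λ p → ∃ λ P → All Big P × u ≡ oneIf p ++ expand P × contract p P ≡ h

ρStep-preimage : ∀ {h u v} → ρStep u v → ρPreimage h v → ρPreimage h u
ρStep-preimage (ρ-i pre a b post big-a big-b) (p , P , big , v≡ , h≡)
  with oneIf-++-big p (expand P) pre (suc a) (1 ∷ suc b ∷ post) (≤-trans big-a (n≤1+n a)) (sym v≡)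
... | pre′ , refl , e with expand-dropEar pre′ a b post P big big-a big-b e
... | P′ , big′ , e′ , contracted , _ =
  p , P′ , big′ , trans (++-assoc (oneIf p) pre′ _) (cong (oneIf p ++_) (sym e′)) , trans (contracted p) h≡
ρStep-preimage (ρ-ii a rest big-a) (false , [] , _ , () , _)
ρStep-preimage (ρ-ii a rest big-a) (false , (x , β) ∷ P , big-x ∷ _ , v≡ , _) =
  ⊥-elim (<-irrefl (proj₁ (∷-injective v≡)) big-x)
ρStep-preimage (ρ-ii a rest big-a) (true , [] , _ , () , _)
ρStep-preimage (ρ-ii a rest big-a) (true , (x , β) ∷ P , _ ∷ big , v≡ , h≡) with ∷-injective (proj₂ (∷-injective v≡))
... | refl , rest≡ =
  false , (a , β) ∷ P , big-a ∷ big , cong (a ∷_) rest≡ ,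
  trans (cong (_∷ contract β P) (sym (contractEntry-dropEarˡ a β))) h≡
ρStep-preimage (ρ-iii rest a big-a) (p , P , big , v≡ , h≡)
  with oneIf-++-big p (expand P) rest (suc a) (1 ∷ []) (≤-trans big-a (n≤1+n a)) (sym v≡)
... | rest′ , refl , e with expand-split rest′ (suc a) [] P big (≤-trans big-a (n≤1+n a)) e
... | P₁ , _ ∷ _ , _ , _ , ()
... | P₁ , [] , refl , e₁ , _ = p , P₁ ++ (a , false) ∷ [] , big′ , u≡ , trans (sym (contract-dropLastEar p P₁ a)) h≡
  where
  big′ : All Big (P₁ ++ (a , false) ∷ [])
  big′ with AllP.++⁻ P₁ big
  ... | big₁ , _ ∷ [] = AllP.++⁺ big₁ (big-a ∷ [])
  u≡ : (oneIf p ++ rest′) ++ a ∷ [] ≡ oneIf p ++ expand (P₁ ++ (a , false) ∷ [])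
  u≡ = trans (++-assoc (oneIf p) rest′ (a ∷ [])) (cong (oneIf p ++_) (sym (trans (expand-++ P₁ _) (cong (_++ a ∷ []) e₁))))

ρSteps-preimage : ∀ {h u v} → Star ρStep u v → ρPreimage h v → ρPreimage h u
ρSteps-preimage ε             pre = pre
ρSteps-preimage (step ◅ steps) pre = ρStep-preimage step (ρSteps-preimage steps pre)

All-Big-ψBlocks : ∀ c → All Big (ψBlocks c)
All-Big-ψBlocks []      = []
All-Big-ψBlocks (y ∷ c) = subst (1 <_) (+-comm 2 y) (s≤s (s≤s z≤n)) ∷ All-Big-ψBlocks c

contract-ψBlocks : ∀ c → contract true (ψBlocks c) ≡ c
contract-ψBlocks []      = refl
contract-ψBlocks (y ∷ c) = cong₂ _∷_ entry (contract-ψBlocks c)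
  where
  entry : contractEntry (y + 2) true true ≡ y
  entry = trans (cong (_∸ 2) (trans (+-identityʳ (y + 2 + 0)) (+-identityʳ (y + 2)))) (m+n∸n≡m y 2)

ρRel-ιψ⁻¹ : ∀ {f h} → ρRel f (ι (ψ h)) → ρPreimage h f
ρRel-ιψ⁻¹ {h = h} (steps , _) =
  ρSteps-preimage steps (true , ψBlocks h , All-Big-ψBlocks h , cong (1 ∷_) (ψ≡expand-ψBlocks h) , contract-ψBlocks h)

δRel-Dih : ∀ {c d g} → Dih c d → δRel d g → ∃ λ g′ → δRel c g′ × Dih g g′
δRel-Dih {c} c~d (ε , normal) =
  c , (ε , λ h (r , c~r , step) → normal h (r , Dih-trans (Dih-sym c~d) c~r , step)) , Dih-sym c~d
δRel-Dih {g = g} c~d ((r , d~r , step) ◅ steps , normal) =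
  g , ((r , Dih-trans c~d d~r , step) ◅ steps , normal) , Dih-refl g

CycStep-canonical : ∀ {u v} → CycStep u v →
  ∃ λ a → ∃ λ b → ∃ λ w → 1 < a × 1 < b × Dih u (a ∷ b ∷ w) × Dih v (suc a ∷ 1 ∷ suc b ∷ w)
CycStep-canonical (δ-i pre a b post big-a big-b) =
  a , b , post ++ pre , big-a , big-b , Dih-swap pre (a ∷ b ∷ post) , Dih-swap pre (suc a ∷ 1 ∷ suc b ∷ post)
CycStep-canonical (δ-ii a mid b big-a big-b) =
  b , a , mid , big-b , big-a , Dih-swap (a ∷ mid) (b ∷ []) , Dih-swap (suc a ∷ mid) (suc b ∷ 1 ∷ [])

-- By δRel-expand and δRel-ψ⁻¹ these are the c with δ(c) a representative of ψ(e).
δPreimage : List ℕ → List ℕ → Set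
δPreimage e u = ∃ λ P → All Big P × Dih u (expand P) × Dih e (contractCycle P)

δStep-preimage : ∀ {e u v} → δStep u v → δPreimage e v → δPreimage e u
δStep-preimage (u′ , u~u′ , step) (P , big , v~P , e~P) with CycStep-canonical step
... | a , b , w , big-a , big-b , u′~ , v~
  with expand-Dih P (suc a) (1 ∷ suc b ∷ w) (Dih-trans (Dih-sym v~P) v~) (≤-trans big-a (n≤1+n a))
... | P′ , e′ , e~P′ , bigP′ with expand-dropEar [] a b w P′ (bigP′ big) big-a big-b (sym e′)
... | P″ , big″ , e″ , _ , cycle≡ =
  P″ , big″ , Dih-trans u~u′ (subst (Dih u′) (sym e″) u′~) , Dih-trans e~P (subst (Dih _) (sym cycle≡) e~P′)

δSteps-preimage : ∀ {e u v} → Star δStep u v → δPreimage e v → δPreimage e u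
δSteps-preimage ε             pre = pre
δSteps-preimage (step ◅ steps) pre = δStep-preimage step (δSteps-preimage steps pre)

δRel-ψ⁻¹ : ∀ {c g e} → δRel c g → Dih (ψ e) g → ∃ λ P → All Big P × Dih c (expand P) × contractCycle P ≡ e
δRel-ψ⁻¹ {e = e} (steps , _) ψe~g with δSteps-preimage steps (ψBlocks e , All-Big-ψBlocks e , g~ψBlocks , e~contracted)
  where
  g~ψBlocks = subst (Dih _) (ψ≡expand-ψBlocks e) (Dih-sym ψe~g)
  e~contracted = subst (Dih e) (sym contracted) (Dih-refl e)
    where
    contracted = trans (cong (λ q → contract q (ψBlocks e)) (lastFlag-flagged (ψBlocks e) (AllFlagged-ψBlocks e)))
                       (contract-ψBlocks e)
... | P , big , c~P , e~P with contractCycle-Dih P e (Dih-sym e~P)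
... | P′ , e≡ , P~P′ , bigP′ , _ = P′ , bigP′ big , Dih-trans c~P P~P′ , sym e≡

-- Cyclic windows

module _ {A : Set} where

  repeatN : ℕ → List A → List A
  repeatN zero    s = []
  repeatN (suc N) s = s ++ repeatN N s

  length-repeatN : ∀ N (s : List A) → length (repeatN N s) ≡ N * length s
  length-repeatN zero    s = refl
  length-repeatN (suc N) s = trans (length-++ s) (cong (length s +_) (length-repeatN N s))

  take-++ˡ : ∀ L (xs ys : List A) → L ≤ length xs → take L (xs ++ ys) ≡ take L xs
  take-++ˡ zero    xs       ys _       = refl
  take-++ˡ (suc L) (x ∷ xs) ys (s≤s l) = cong (x ∷_) (take-++ˡ L xs ys l)

  take-++ʳ : ∀ j (xs ys : List A) → take (length xs + j) (xs ++ ys) ≡ xs ++ take j ys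
  take-++ʳ j []       ys = refl
  take-++ʳ j (x ∷ xs) ys = cong (x ∷_) (take-++ʳ j xs ys)

  length-take≤ : ∀ L (xs : List A) → length (take L xs) ≤ L
  length-take≤ L xs = ≤-trans (≤-reflexive (length-take L xs)) (m⊓n≤m L (length xs))

≤-suc-* : ∀ L m → 0 < m → L ≤ suc L * m
≤-suc-* L m pos = ≤-trans (n≤1+n L) (≤-trans (≤-reflexive (sym (*-identityʳ (suc L)))) (*-monoʳ-≤ (suc L) pos))

nth-++ˡ : ∀ xs ys i → i < length xs → nth (xs ++ ys) i ≡ nth xs i
nth-++ˡ (x ∷ xs) ys zero    _       = refl
nth-++ˡ (x ∷ xs) ys (suc i) (s≤s l) = nth-++ˡ xs ys i l

nth-++ʳ : ∀ xs ys i → nth (xs ++ ys) (length xs + i) ≡ nth ys i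
nth-++ʳ []       ys i = refl
nth-++ʳ (x ∷ xs) ys i = nth-++ʳ xs ys i

nth-take : ∀ L (zs : List ℕ) i → i < L → nth (take L zs) i ≡ nth zs i
nth-take (suc L) []       i       _       = refl
nth-take (suc L) (z ∷ zs) zero    _       = refl
nth-take (suc L) (z ∷ zs) (suc i) (s≤s l) = nth-take L zs i l

nth-ext : ∀ (xs ys : List ℕ) → length xs ≡ length ys → (∀ i → i < length xs → nth xs i ≡ nth ys i) → xs ≡ ys
nth-ext []       []       _ _ = refl
nth-ext (x ∷ xs) (y ∷ ys) e h = cong₂ _∷_ (h 0 (s≤s z≤n)) (nth-ext xs ys (suc-injective e) (λ i l → h (suc i) (s≤s l)))

cycAt≡nth : ∀ s i → i < length s → cycAt s i ≡ nth s i
cycAt≡nth (x ∷ xs) i l = cong (nth (x ∷ xs)) (m<n⇒m%n≡m l)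

cycAt-+length : ∀ s i → cycAt s (i + length s) ≡ cycAt s i
cycAt-+length []       i = refl
cycAt-+length (x ∷ xs) i = cong (nth (x ∷ xs)) ([m+n]%n≡m%n i (suc (length xs)))

cycAt-% : ∀ s j n → length s ≡ suc n → cycAt s j ≡ cycAt s (j % suc n)
cycAt-% (x ∷ xs) j n refl = cong (nth (x ∷ xs)) (sym (m%n%n≡m%n j (suc n)))

cycAt-rot-< : ∀ x xs m → m < suc (length xs) → cycAt (rot (x ∷ xs)) m ≡ cycAt (x ∷ xs) (suc m)
cycAt-rot-< x xs m l with m <? length xs
... | yes m<n = begin
  cycAt (xs ++ x ∷ []) m  ≡⟨ cycAt≡nth (xs ++ x ∷ []) m (≤-trans (m≤n⇒m≤1+n m<n) (≤-reflexive (sym length-snoc))) ⟩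
  nth (xs ++ x ∷ []) m    ≡⟨ nth-++ˡ xs (x ∷ []) m m<n ⟩
  nth xs m                ≡⟨ cycAt≡nth (x ∷ xs) (suc m) (s≤s m<n) ⟨
  cycAt (x ∷ xs) (suc m)  ∎
  where open ≡-Reasoning
        length-snoc = trans (length-++ xs) (+-comm (length xs) 1)
... | no m≮n with ≤-antisym (s≤s⁻¹ l) (≮⇒≥ m≮n)
...   | refl = begin
  cycAt (xs ++ x ∷ []) (length xs)      ≡⟨ cycAt≡nth (xs ++ x ∷ []) (length xs) (≤-reflexive (sym length-snoc)) ⟩
  nth (xs ++ x ∷ []) (length xs)        ≡⟨ cong (nth (xs ++ x ∷ [])) (+-identityʳ (length xs)) ⟨
  nth (xs ++ x ∷ []) (length xs + 0)    ≡⟨ nth-++ʳ xs (x ∷ []) 0 ⟩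
  x                                     ≡⟨ cycAt-+length (x ∷ xs) 0 ⟨
  cycAt (x ∷ xs) (suc (length xs))      ∎
  where open ≡-Reasoning
        length-snoc = trans (length-++ xs) (+-comm (length xs) 1)

cycAt-rot : ∀ s j → cycAt (rot s) j ≡ cycAt s (suc j)
cycAt-rot []       j = refl
cycAt-rot (x ∷ xs) j = begin
  cycAt (rot (x ∷ xs)) j                    ≡⟨ cycAt-% (xs ++ x ∷ []) j (length xs) length-snoc ⟩
  cycAt (rot (x ∷ xs)) (j % n)              ≡⟨ cycAt-rot-< x xs (j % n) (m%n<n j n) ⟩
  cycAt (x ∷ xs) (suc (j % n))              ≡⟨ cycAt-% (x ∷ xs) (suc (j % n)) (length xs) refl ⟩
  cycAt (x ∷ xs) (suc (j % n) % n)          ≡⟨ cong (cycAt (x ∷ xs)) suc-% ⟨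
  cycAt (x ∷ xs) (suc j % n)                ≡⟨ cycAt-% (x ∷ xs) (suc j) (length xs) refl ⟨
  cycAt (x ∷ xs) (suc j)                    ∎
  where
  open ≡-Reasoning
  n = suc (length xs)
  length-snoc : length (xs ++ x ∷ []) ≡ n
  length-snoc = trans (length-++ xs) (+-comm (length xs) 1)
  suc-% : suc j % n ≡ suc (j % n) % n
  suc-% = trans (%-distribˡ-+ 1 j n)
    (trans (cong (λ t → (1 % n + t) % n) (sym (m%n%n≡m%n j n))) (sym (%-distribˡ-+ 1 (j % n) n)))

cycAt-rotN : ∀ k s i → cycAt (rotN k s) i ≡ cycAt s (k + i)
cycAt-rotN zero    s i = refl
cycAt-rotN (suc k) s i = trans (cycAt-rot (rotN k s) i) (trans (cycAt-rotN k s (suc i)) (cong (cycAt s) (+-suc k i)))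

nth-repeatN : ∀ N s i → i < N * length s → nth (repeatN N s) i ≡ cycAt s i
nth-repeatN zero    s i ()
nth-repeatN (suc N) s i l with i <? length s
... | yes i<s = trans (nth-++ˡ s (repeatN N s) i i<s) (sym (cycAt≡nth s i i<s))
... | no i≮s with m≤n⇒∃[o]m+o≡n (≮⇒≥ i≮s)
...   | i′ , refl = begin
  nth (s ++ repeatN N s) (length s + i′) ≡⟨ nth-++ʳ s (repeatN N s) i′ ⟩
  nth (repeatN N s) i′                   ≡⟨ nth-repeatN N s i′ (+-cancelˡ-< (length s) i′ (N * length s) l) ⟩
  cycAt s i′                             ≡⟨ cycAt-+length s i′ ⟨
  cycAt s (i′ + length s)                ≡⟨ cong (cycAt s) (+-comm i′ (length s)) ⟩
  cycAt s (length s + i′)                ∎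
  where open ≡-Reasoning

⊆-window : ∀ f s → 0 < length s → (∀ i → i < length f → nth f i ≡ cycAt s i) →
           f ≡ take (length f) (repeatN (suc (length f)) s)
⊆-window f s pos h = nth-ext f _ (sym (trans (length-take L _) (m≤n⇒m⊓n≡m long))) nth≡
  where
  L = length f
  bound = ≤-suc-* L (length s) pos
  long : L ≤ length (repeatN (suc L) s)
  long = ≤-trans bound (≤-reflexive (sym (length-repeatN (suc L) s)))
  nth≡ : ∀ i → i < L → nth f i ≡ nth (take L (repeatN (suc L) s)) i
  nth≡ i l = trans (h i l) (trans (sym (nth-repeatN (suc L) s i (<-≤-trans l bound))) (sym (nth-take L _ i l)))

prefix⇒⊆ᶜ : ∀ {c R} f g N Z → Dih c R → f ++ g ≡ repeatN N R ++ Z → length f ≤ N * length R → f ⊆ᶜ c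
prefix⇒⊆ᶜ {R = R} f g N Z c~R e l = R , c~R , 0 , λ i i<f → begin
  nth f i                    ≡⟨ nth-++ˡ f g i i<f ⟨
  nth (f ++ g) i             ≡⟨ cong (λ t → nth t i) e ⟩
  nth (repeatN N R ++ Z) i
    ≡⟨ nth-++ˡ (repeatN N R) Z i (<-≤-trans i<f (≤-trans l (≤-reflexive (sym (length-repeatN N R))))) ⟩
  nth (repeatN N R) i        ≡⟨ nth-repeatN N R i (<-≤-trans i<f l) ⟩
  cycAt R i                  ∎
  where open ≡-Reasoning

contract-take : ∀ L q P → take L (contract q P) ≡ contract q (take L P)
contract-take zero    q P             = refl
contract-take (suc L) q []            = refl
contract-take (suc L) q ((x , b) ∷ P) = cong (contractEntry x q b ∷_) (contract-take L b P)

contract-repeatN : ∀ N p P → contract (lastFlag true (p ∷ P)) (repeatN N (p ∷ P)) ≡ repeatN N (contractCycle (p ∷ P))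
contract-repeatN zero    p P = refl
contract-repeatN (suc N) p P =
  trans (contract-++ (lastFlag true (p ∷ P)) (p ∷ P) (repeatN N (p ∷ P)))
        (cong (contractCycle (p ∷ P) ++_)
              (trans (cong (λ q → contract q (repeatN N (p ∷ P))) (sym (lastFlag-∷ true (lastFlag true (p ∷ P)) p P)))
                     (contract-repeatN N p P)))

expand-repeatN : ∀ N P → expand (repeatN N P) ≡ repeatN N (expand P)
expand-repeatN zero    P = refl
expand-repeatN (suc N) P = trans (expand-++ P (repeatN N P)) (cong (expand P ++_) (expand-repeatN N P))

All-repeatN : ∀ {Q : Block → Set} N P → All Q P → All Q (repeatN N P)
All-repeatN zero    P a = []
All-repeatN (suc N) P a = AllP.++⁺ a (All-repeatN N P a)

-- The part of the expansion above the first L blocks of P read cyclically, together with the 1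
-- that ends the last block of P.
blockWindow : ℕ → List Block → List ℕ
blockWindow L P = oneIf (lastFlag true P) ++ expand (take L (repeatN (suc L) P))

blockWindow-ρRel : ∀ L p P → All Big (p ∷ P) →
  ρRel (blockWindow (suc L) (p ∷ P)) (ι (ψ (take (suc L) (repeatN (suc (suc L)) (contractCycle (p ∷ P))))))
blockWindow-ρRel L p P big =
  subst (λ t → ρRel (blockWindow (suc L) (p ∷ P)) (ι (ψ t))) contracted
        (ρRel-expand (lastFlag true (p ∷ P)) p (take L (P ++ repeatN (suc L) (p ∷ P)))
                     (AllP.take⁺ (suc L) (All-repeatN (suc (suc L)) (p ∷ P) big)))
  where
  contracted : contract (lastFlag true (p ∷ P)) (take (suc L) (repeatN (suc (suc L)) (p ∷ P)))
             ≡ take (suc L) (repeatN (suc (suc L)) (contractCycle (p ∷ P)))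
  contracted = trans (sym (contract-take (suc L) (lastFlag true (p ∷ P)) (repeatN (suc (suc L)) (p ∷ P))))
                     (cong (take (suc L)) (contract-repeatN (suc (suc L)) p P))

-- Moving the final 1 of expand P to the front makes the 1 before the window part of the repetition.
expand-repeatN-shift : ∀ N p P → ∃ λ R → Dih (expand (p ∷ P)) R × length R ≡ length (expand (p ∷ P)) ×
  oneIf (lastFlag true (p ∷ P)) ++ expand (repeatN N (p ∷ P)) ≡ repeatN N R ++ oneIf (lastFlag true (p ∷ P))
expand-repeatN-shift N p P with lastFlag true (p ∷ P) in last
... | false = expand (p ∷ P) , Dih-refl _ , refl ,
              trans (expand-repeatN N (p ∷ P)) (sym (++-identityʳ _))
... | true  = 1 ∷ expandInit (p ∷ P) ,
              subst (λ t → Dih t (1 ∷ expandInit (p ∷ P))) (sym split) (Dih-swap (expandInit (p ∷ P)) (1 ∷ [])) ,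
              trans (+-comm 1 (length (expandInit (p ∷ P))))
                    (trans (sym (length-++ (expandInit (p ∷ P)))) (cong length (sym split))) ,
              trans (cong (1 ∷_) (expand-repeatN N (p ∷ P)))
                    (trans (cong (λ t → 1 ∷ repeatN N t) split) (shift N (expandInit (p ∷ P))))
  where
  split : expand (p ∷ P) ≡ expandInit (p ∷ P) ++ 1 ∷ []
  split = expand≡expandInit∷ʳ1 p P last
  shift : ∀ N (xs : List ℕ) → 1 ∷ repeatN N (xs ++ 1 ∷ []) ≡ repeatN N (1 ∷ xs) ++ 1 ∷ []
  shift zero    xs = refl
  shift (suc N) xs = cong (1 ∷_) (trans (++-assoc xs (1 ∷ []) _)
    (trans (cong (xs ++_) (shift N xs)) (sym (++-assoc xs (repeatN N (1 ∷ xs)) (1 ∷ [])))))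

blockWindow-⊆ᶜ : ∀ L P → 2 ≤ length P → blockWindow L P ⊆ᶜ expand P
blockWindow-⊆ᶜ L (p ∷ P) l with expand-repeatN-shift (suc L) p P
... | R , P~R , length-R , e = prefix⇒⊆ᶜ (blockWindow L (p ∷ P)) (expand (drop L Q)) (suc L) _ P~R glued bound
  where
  Q = repeatN (suc L) (p ∷ P)
  glued : blockWindow L (p ∷ P) ++ expand (drop L Q) ≡ repeatN (suc L) R ++ _
  glued = trans (++-assoc (oneIf (lastFlag true (p ∷ P))) _ _)
    (trans (cong (oneIf (lastFlag true (p ∷ P)) ++_)
                 (trans (sym (expand-++ (take L Q) (drop L Q))) (cong expand (take++drop≡id L Q))))
           e)
  oneIf≤1 : ∀ b → length (oneIf b) ≤ 1
  oneIf≤1 true  = s≤s z≤n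
  oneIf≤1 false = z≤n
  bound : length (blockWindow L (p ∷ P)) ≤ suc L * length R
  bound = begin
    length (blockWindow L (p ∷ P))   ≡⟨ length-++ (oneIf (lastFlag true (p ∷ P))) ⟩
    _ + length (expand (take L Q))
      ≤⟨ +-mono-≤ (oneIf≤1 (lastFlag true (p ∷ P))) (≤-trans (length-expand≤ (take L Q)) (*-monoʳ-≤ 2 (length-take≤ L Q))) ⟩
    1 + 2 * L                        ≤⟨ n≤1+n _ ⟩
    2 + 2 * L                        ≡⟨ *-suc 2 L ⟨
    2 * suc L                        ≡⟨ *-comm 2 (suc L) ⟩
    suc L * 2
      ≤⟨ *-monoʳ-≤ (suc L) (≤-trans l (≤-trans (length≤length-expand (p ∷ P)) (≤-reflexive (sym length-R)))) ⟩
    suc L * length R                 ∎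
    where open ≤-Reasoning

0<length-expandInit : ∀ p P → 0 < length (expandInit (p ∷ P))
0<length-expandInit (x , b) []      = s≤s z≤n
0<length-expandInit (x , b) (_ ∷ _) = s≤s z≤n

lastOne<length-expand : ∀ p P → length (oneIf (lastFlag true (p ∷ P))) < length (expand (p ∷ P))
lastOne<length-expand p P = <-≤-trans (m<n+m _ (0<length-expandInit p P))
  (≤-reflexive (sym (trans (cong length (expand≡expandInit++ p P)) (length-++ (expandInit (p ∷ P))))))

blockWindow-shorter : ∀ L P → L < length P → length (blockWindow L P) < length (expand P)
blockWindow-shorter L P L<P with drop L P in drop≡
... | [] = ⊥-elim (<⇒≢ (m<n⇒0<n∸m L<P) (sym (trans (sym (length-drop L P)) (cong length drop≡))))
... | d ∷ D = begin-strict
  length (oneIf w ++ expand (take L (P ++ repeatN L P)))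
    ≡⟨ cong (λ t → length (oneIf w ++ expand t)) (take-++ˡ L P _ (<⇒≤ L<P)) ⟩
  length (oneIf w ++ expand (take L P))                    ≡⟨ length-++ (oneIf w) ⟩
  length (oneIf w) + length (expand (take L P))
    <⟨ +-monoˡ-< (length (expand (take L P))) (subst (λ b → length (oneIf b) < length (expand (d ∷ D))) (sym last≡)
                                                     (lastOne<length-expand d D)) ⟩
  length (expand (d ∷ D)) + length (expand (take L P))     ≡⟨ +-comm _ (length (expand (take L P))) ⟩
  length (expand (take L P)) + length (expand (d ∷ D))     ≡⟨ length-++ (expand (take L P)) ⟨
  length (expand (take L P) ++ expand (d ∷ D))             ≡⟨ cong length (expand-++ (take L P) (d ∷ D)) ⟨
  length (expand (take L P ++ d ∷ D))                      ≡⟨ cong (length ∘ expand) split ⟩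
  length (expand P)                                        ∎
  where
  open ≤-Reasoning
  w = lastFlag true P
  split : take L P ++ d ∷ D ≡ P
  split = trans (cong (take L P ++_) (sym drop≡)) (take++drop≡id L P)
  last≡ : lastFlag true P ≡ lastFlag true (d ∷ D)
  last≡ = trans (cong (lastFlag true) (sym split))
                (trans (lastFlag-++ true (take L P) (d ∷ D)) (lastFlag-∷ (lastFlag true (take L P)) true d D))

blockWindow-longer : ∀ L P → 0 < length P → length P < L → length (expand P) < length (blockWindow L P)
blockWindow-longer L (p ∷ P) _ P<L with m≤n⇒∃[o]m+o≡n P<L
... | o , refl = begin-strict
  length (expand (p ∷ P))                                      <⟨ m<m+n _ (s≤s z≤n) ⟩
  length (expand (p ∷ P)) + length (expand (p ∷ _))            ≡⟨ length-++ (expand (p ∷ P)) ⟨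
  length (expand (p ∷ P) ++ expand (take (suc o) Q))           ≡⟨ cong length (expand-++ (p ∷ P) _) ⟨
  length (expand ((p ∷ P) ++ take (suc o) Q))                  ≡⟨ cong (length ∘ expand) (take-++ʳ (suc o) (p ∷ P) Q) ⟨
  length (expand (take (length (p ∷ P) + suc o) ((p ∷ P) ++ Q)))
    ≡⟨ cong (λ n → length (expand (take n ((p ∷ P) ++ Q)))) (+-suc _ o) ⟩
  length (expand (take L′ ((p ∷ P) ++ Q)))                     ≤⟨ m≤n+m _ (length (oneIf (lastFlag true (p ∷ P)))) ⟩
  length (oneIf (lastFlag true (p ∷ P))) + length (expand (take L′ ((p ∷ P) ++ Q)))
    ≡⟨ length-++ (oneIf (lastFlag true (p ∷ P))) ⟨
  length (blockWindow L′ (p ∷ P))                              ∎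
  where
  open ≤-Reasoning
  L′ = suc (length (p ∷ P)) + o
  Q = repeatN L′ (p ∷ P)

⊆ᶜ-Dih : ∀ {f c d} → Dih c d → f ⊆ᶜ d → f ⊆ᶜ c
⊆ᶜ-Dih c~d (d′ , d~d′ , window) = d′ , Dih-trans c~d d~d′ , window

window-lift : ∀ P f → All Big P → 2 ≤ length P → 0 < length f → f ⊆ᶜ contractCycle P → ¬ Dih (contractCycle P) f →
  ∃ λ f′ → ρRel f′ (ι (ψ f)) × f′ ⊊ᶜ expand P
window-lift P (y ∷ f) big l _ (r , P~r , k , window) f≁P with contractCycle-Dih P (rotN k r) (Dih-rotN k P~r)
... | [] , _ , _ , _ , length≡ = ⊥-elim (<⇒≢ (<-≤-trans (s≤s z≤n) l) length≡)
... | p ∷ P′ , r≡ , P~P′ , bigP′ , length≡ =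
  blockWindow L (p ∷ P′) ,
  subst (λ t → ρRel (blockWindow L (p ∷ P′)) (ι (ψ t))) (sym f≡) (blockWindow-ρRel (length f) p P′ (bigP′ big)) ,
  ⊆ᶜ-Dih {blockWindow L (p ∷ P′)} P~P′ (blockWindow-⊆ᶜ L (p ∷ P′) (≤-trans l (≤-reflexive (sym length≡)))) ,
  proper
  where
  L = length (y ∷ f)
  s = contractCycle (p ∷ P′)
  f≡ : y ∷ f ≡ take L (repeatN (suc L) s)
  f≡ = ⊆-window (y ∷ f) s
         (<-≤-trans (s≤s z≤n) (≤-trans l (≤-reflexive (sym (trans (length-contract (lastFlag true (p ∷ P′)) (p ∷ P′)) length≡)))))
         (λ i i<L → trans (window i i<L) (trans (sym (cycAt-rotN k r i)) (cong (λ t → cycAt t i) r≡)))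
  proper : ¬ Dih (expand P) (blockWindow L (p ∷ P′))
  proper P~f′ with <-cmp L (length (p ∷ P′))
  ... | tri< L<m _ _ = <-irrefl same-length (blockWindow-shorter L (p ∷ P′) L<m)
    where same-length = trans (Dih-length P~f′) (sym (Dih-length P~P′))
  ... | tri> _ _ m<L = <-irrefl (sym same-length) (blockWindow-longer L (p ∷ P′) (s≤s z≤n) m<L)
    where same-length = trans (Dih-length P~f′) (sym (Dih-length P~P′))
  ... | tri≈ _ L≡m _ = f≁P (subst (Dih (contractCycle P)) (trans r≡ (sym f≡s)) (Dih-rotN k P~r))
    where
    f≡s : y ∷ f ≡ s
    f≡s = trans f≡ (trans (take-++ˡ L s _ (≤-reflexive length-s)) (take-all L s (≤-reflexive (sym length-s))))
      where length-s = trans L≡m (sym (length-contract (lastFlag true (p ∷ P′)) (p ∷ P′)))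

-- Enumerating expansions and the sets E′ and F′

QC-contractCycle : ∀ P → All Big P → 2 ≤ length P → QC (expand P) → QC (contractCycle P)
QC-contractCycle P big l q =
  QC-ψ⁻¹ (δSteps-QC (proj₁ (δRel-expand P big l)) q) (≤-trans l (≤-reflexive (sym (length-contract _ P))))

QC-expand : ∀ P → All Big P → 2 ≤ length P → QC (contractCycle P) → QC (expand P)
QC-expand P big l q = δSteps-QC⁻¹ (proj₁ (δRel-expand P big l)) (QC-ψ q)

expansion-not-small : ∀ {c s} p P → All Big (p ∷ P) → Dih (expand (p ∷ P)) c → All (_≤ 1) s → ¬ Dih s c
expansion-not-small {c} (x , _) P (big ∷ _) P~c small s~c =
  noBig (Perm.All-resp-↭ (Dih⇒↭ s~c) small) (Perm.Any-resp-↭ (Dih⇒↭ P~c) (here big))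
  where
  noBig : ∀ {c} → All (_≤ 1) c → Any (1 <_) c → ⊥
  noBig (≤1 ∷ _) (here >1) = <⇒≱ >1 ≤1
  noBig (_ ∷ ≤1) (there >1) = noBig ≤1 >1

noOne≤1 : ∀ b → noOne b ≤ 1
noOne≤1 true  = z≤n
noOne≤1 false = s≤s z≤n

contractEntry-false : ∀ x → contractEntry x false false ≡ x
contractEntry-false x = trans (cong (_∸ 2) (+-assoc x 1 1)) (m+n∸n≡m x 2)

-- An entry 1 of the contraction comes from an entry x ≥ 2 next to at least one 1.
1∈contract⇒1∈expansion : ∀ p P → All Big P → 1 ∈ contract p P → 1 ∈ oneIf p ++ expand P
1∈contract⇒1∈expansion true  P                  _            _          = here refl
1∈contract⇒1∈expansion false ((x , true) ∷ P)   _            _          = there (here refl)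
1∈contract⇒1∈expansion false ((x , false) ∷ P)  (big ∷ _)    (here 1≡)  =
  ⊥-elim (<-irrefl (trans 1≡ (contractEntry-false x)) big)
1∈contract⇒1∈expansion false ((x , false) ∷ P)  (_ ∷ bigP)   (there 1∈) = there (1∈contract⇒1∈expansion false P bigP 1∈)

1∈contract⇒length< : ∀ p P → All Big P → 1 ∈ contract p P → length P < length (oneIf p ++ expand P)
1∈contract⇒length< true  P                 _          _          = s≤s (length≤length-expand P)
1∈contract⇒length< false ((x , true) ∷ P)  _          _          = s≤s (s≤s (length≤length-expand P))
1∈contract⇒length< false ((x , false) ∷ P) (big ∷ _)  (here 1≡)  = ⊥-elim (<-irrefl (trans 1≡ (contractEntry-false x)) big)
1∈contract⇒length< false ((x , false) ∷ P) (_ ∷ bigP) (there 1∈) = s≤s (1∈contract⇒length< false P bigP 1∈)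

allFlags : ℕ → List (List Bool)
allFlags zero    = [] ∷ []
allFlags (suc n) = map (true ∷_) (allFlags n) ++ map (false ∷_) (allFlags n)

∈-allFlags : ∀ bs → bs ∈ allFlags (length bs)
∈-allFlags []           = here refl
∈-allFlags (true ∷ bs)  = ∈-++⁺ˡ (∈-map⁺ (true ∷_) (∈-allFlags bs))
∈-allFlags (false ∷ bs) = ∈-++⁺ʳ (map (true ∷_) (allFlags (length bs))) (∈-map⁺ (false ∷_) (∈-allFlags bs))

∈-allFlags⁻ : ∀ n {bs} → bs ∈ allFlags n → length bs ≡ n
∈-allFlags⁻ zero    (here refl) = refl
∈-allFlags⁻ (suc n) bs∈ with ∈-++⁻ (map (true ∷_) (allFlags n)) bs∈
... | inj₁ bs∈′ with ∈-map⁻ (true ∷_) bs∈′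
...   | bs′ , bs′∈ , refl = cong suc (∈-allFlags⁻ n bs′∈)
∈-allFlags⁻ (suc n) bs∈ | inj₂ bs∈′ with ∈-map⁻ (false ∷_) bs∈′
...   | bs′ , bs′∈ , refl = cong suc (∈-allFlags⁻ n bs′∈)

-- The blocks with flags bs contracting to e (for a cycle, q is the last flag).
uncontract : Bool → List ℕ → List Bool → List Block
uncontract q (y ∷ e) (b ∷ bs) = (y + 2 ∸ (noOne q + noOne b) , b) ∷ uncontract b e bs
uncontract q _       _        = []

flags : List Block → List Bool
flags = map proj₂

contract-uncontract : ∀ q e bs → length e ≡ length bs → contract q (uncontract q e bs) ≡ e
contract-uncontract q []      []       _ = refl
contract-uncontract q (y ∷ e) (b ∷ bs) l = cong₂ _∷_ entry (contract-uncontract b e bs (suc-injective l))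
  where
  missing≤ : noOne q + noOne b ≤ y + 2
  missing≤ = ≤-trans (+-mono-≤ (noOne≤1 q) (noOne≤1 b)) (m≤n+m 2 y)
  entry : contractEntry (y + 2 ∸ (noOne q + noOne b)) q b ≡ y
  entry = trans (cong (_∸ 2) (trans (+-assoc (y + 2 ∸ (noOne q + noOne b)) (noOne q) (noOne b)) (m∸n+n≡m missing≤)))
                (m+n∸n≡m y 2)

uncontract-contract : ∀ q P → All Big P → uncontract q (contract q P) (flags P) ≡ P
uncontract-contract q []            _           = refl
uncontract-contract q ((x , b) ∷ P) (big ∷ bigP) = cong₂ _∷_ (cong (_, b) entry) (uncontract-contract b P bigP)
  where
  regroup : ∀ x s t → t + (s + x) ≡ x + (s + t)
  regroup = solve-∀
  entry : contractEntry x q b + 2 ∸ (noOne q + noOne b) ≡ x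
  entry = trans (cong (_∸ (noOne q + noOne b)) (trans (contractEntry+2 x q b big) (regroup x (noOne q) (noOne b))))
                (m+n∸n≡m x (noOne q + noOne b))

length-uncontract : ∀ q e bs → length e ≡ length bs → length (uncontract q e bs) ≡ length e
length-uncontract q []      []       _ = refl
length-uncontract q (y ∷ e) (b ∷ bs) l = cong suc (length-uncontract b e bs (suc-injective l))

lastOr : Bool → List Bool → Bool
lastOr q []       = q
lastOr q (b ∷ bs) = lastOr b bs

lastFlag-uncontract : ∀ q q′ e bs → length e ≡ length bs → lastFlag q (uncontract q′ e bs) ≡ lastOr q bs
lastFlag-uncontract q q′ []      []       _ = refl
lastFlag-uncontract q q′ (y ∷ e) (b ∷ bs) l = lastFlag-uncontract b b e bs (suc-injective l)

lastOr-flags : ∀ q P → lastOr q (flags P) ≡ lastFlag q P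
lastOr-flags q []            = refl
lastOr-flags q ((_ , b) ∷ P) = lastOr-flags b P

uncontractCycle : List ℕ → List Bool → List Block
uncontractCycle e bs = uncontract (lastOr true bs) e bs

big? : ∀ p → Dec (Big p)
big? (x , _) = 1 <? x

expansionsOfCycle : List ℕ → List (List ℕ)
expansionsOfCycle e = map expand (filter (all? big?) (map (uncontractCycle e) (allFlags (length e))))

∈-expansionsOfCycle⁻ : ∀ {c} e → c ∈ expansionsOfCycle e →
  ∃ λ P → All Big P × c ≡ expand P × contractCycle P ≡ e × length P ≡ length e
∈-expansionsOfCycle⁻ e c∈ with ∈-map∘filter⁻ expand (all? big?) c∈
... | P , P∈ , refl , big with ∈-map⁻ (uncontractCycle e) P∈
... | bs , bs∈ , refl = uncontractCycle e bs , big , refl , contracted , length-uncontract (lastOr true bs) e bs length≡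
  where
  length≡ = sym (∈-allFlags⁻ (length e) bs∈)
  contracted = trans (cong (λ q → contract q (uncontractCycle e bs)) (lastFlag-uncontract true _ e bs length≡))
                     (contract-uncontract _ e bs length≡)

∈-expansionsOfCycle⁺ : ∀ P → All Big P → expand P ∈ expansionsOfCycle (contractCycle P)
∈-expansionsOfCycle⁺ P big = ∈-map∘filter⁺ expand (all? big?) (P , P∈ , refl , big)
  where
  uncontracted : uncontractCycle (contractCycle P) (flags P) ≡ P
  uncontracted = trans (cong (λ q → uncontract q (contractCycle P) (flags P)) (lastOr-flags true P))
                       (uncontract-contract (lastFlag true P) P big)
  length≡ : length (flags P) ≡ length (contractCycle P)
  length≡ = trans (length-map proj₂ P) (sym (length-contract _ P))
  P∈ : P ∈ map (uncontractCycle (contractCycle P)) (allFlags (length (contractCycle P)))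
  P∈ = subst (λ t → t ∈ map (uncontractCycle (contractCycle P)) (allFlags (length (contractCycle P)))) uncontracted
             (∈-map⁺ _ (subst (λ n → flags P ∈ allFlags n) length≡ (∈-allFlags (flags P))))

candidate : List ℕ → Bool → List Bool → Bool × List Block
candidate h p bs = p , uncontract p h bs

windowCandidates : List ℕ → List (Bool × List Block)
windowCandidates h = cartesianProductWith (candidate h) (true ∷ false ∷ []) (allFlags (length h))

windowExpansion : Bool × List Block → List ℕ
windowExpansion (p , P) = oneIf p ++ expand P

allBig? : ∀ (pP : Bool × List Block) → Dec (All Big (proj₂ pP))
allBig? (_ , P) = all? big? P

windowExpansions : List ℕ → List (List ℕ)
windowExpansions h = map windowExpansion (filter allBig? (windowCandidates h))

∈-windowExpansions⁻ : ∀ {f} h → f ∈ windowExpansions h → ρPreimage h f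
∈-windowExpansions⁻ h f∈ with ∈-map∘filter⁻ windowExpansion allBig? f∈
... | (p , P) , pP∈ , refl , big with ∈-cartesianProductWith⁻ (candidate h) (true ∷ false ∷ []) (allFlags (length h)) pP∈
... | p , bs , _ , bs∈ , refl =
  p , uncontract p h bs , big , refl , contract-uncontract p h bs (sym (∈-allFlags⁻ (length h) bs∈))

∈-windowExpansions⁺ : ∀ {f} h → ρPreimage h f → f ∈ windowExpansions h
∈-windowExpansions⁺ h (p , P , big , refl , refl) =
  ∈-map∘filter⁺ windowExpansion allBig? ((p , P) , pP∈ , refl , big)
  where
  p∈ : ∀ p → p ∈ true ∷ false ∷ []
  p∈ true  = here refl
  p∈ false = there (here refl)
  length≡ : length (flags P) ≡ length (contract p P)
  length≡ = trans (length-map proj₂ P) (sym (length-contract p P))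
  pP∈ : (p , P) ∈ windowCandidates (contract p P)
  pP∈ = subst (λ Q → (p , Q) ∈ windowCandidates (contract p P)) (uncontract-contract p P big)
          (∈-cartesianProductWith⁺ (candidate (contract p P)) (p∈ p)
                                   (subst (λ n → flags P ∈ allFlags n) length≡ (∈-allFlags (flags P))))

nextE : List (List ℕ) → List (List ℕ)
nextE E = E ++ concatMap expansionsOfCycle E

nextF : List (List ℕ) → List (List ℕ)
nextF F = concatMap windowExpansions F

∈-nextE⁻ : ∀ {x} E → x ∈ concatMap expansionsOfCycle E →
  ∃ λ e → e ∈ E × ∃ λ P → All Big P × x ≡ expand P × contractCycle P ≡ e × length P ≡ length e
∈-nextE⁻ E x∈ with find (∈-concatMap⁻ expansionsOfCycle x∈)
... | e , e∈ , x∈e = e , e∈ , ∈-expansionsOfCycle⁻ e x∈e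

∈-nextE⁺ : ∀ {e} E P → e ∈ E → All Big P → contractCycle P ≡ e → expand P ∈ concatMap expansionsOfCycle E
∈-nextE⁺ E P e∈ big refl = ∈-concatMap⁺ expansionsOfCycle (lose e∈ (∈-expansionsOfCycle⁺ P big))

∈-nextF⁻ : ∀ {f} F → f ∈ nextF F → ∃ λ h → h ∈ F × ρPreimage h f
∈-nextF⁻ F f∈ with find (∈-concatMap⁻ windowExpansions f∈)
... | h , h∈ , f∈h = h , h∈ , ∈-windowExpansions⁻ h f∈h

∈-nextF⁺ : ∀ {f h} F → h ∈ F → ρPreimage h f → f ∈ nextF F
∈-nextF⁺ F h∈ pre = ∈-concatMap⁺ windowExpansions (lose h∈ (∈-windowExpansions⁺ _ pre))

∈ᶜ-nextE⁻ : ∀ E → All QC E → ∀ c → c ∈ᶜ nextE E → InE' E c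
∈ᶜ-nextE⁻ E qcE c c∈ with AnyP.++⁻ E c∈
... | inj₁ c∈E = inj₁ c∈E
... | inj₂ c∈new with find c∈new
... | x , x∈ , x~c with ∈-nextE⁻ E x∈
... | e , e∈ , p ∷ P , big , refl , refl , length≡ with δRel-Dih (Dih-sym x~c) (δRel-expand (p ∷ P) big long)
  where long = ≤-trans (QC-length≥2 (All.lookup qcE e∈)) (≤-reflexive (sym length≡))
... | g , c→g , ψe~g = inj₂ (nonEmpty , expansion-not-small p P big x~c (z≤n ∷ z≤n ∷ []) ,
                              expansion-not-small p P big x~c (s≤s z≤n ∷ s≤s z≤n ∷ s≤s z≤n ∷ []) ,
                              g , c→g , lose e∈ ψe~g)
  where nonEmpty = <-≤-trans (s≤s z≤n) (≤-reflexive (sym (Dih-length x~c)))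
∈ᶜ-nextE⁻ E qcE c c∈ | inj₂ _ | _ | e , e∈ , [] , _ , _ , refl , length≡ =
  ⊥-elim (<⇒≢ (<-≤-trans (s≤s z≤n) (QC-length≥2 (All.lookup qcE e∈))) length≡)

∈ᶜ-nextE⁺ : ∀ E c → InE' E c → c ∈ᶜ nextE E
∈ᶜ-nextE⁺ E c (inj₁ c∈E) = AnyP.++⁺ˡ c∈E
∈ᶜ-nextE⁺ E c (inj₂ (_ , _ , _ , g , c→g , ψE∋g)) with find ψE∋g
... | e , e∈ , ψe~g with δRel-ψ⁻¹ c→g ψe~g
... | P , big , c~P , cycle≡ = AnyP.++⁺ʳ E (lose (∈-nextE⁺ E P e∈ big cycle≡) (Dih-sym c~P))

∈-nextF⇒InF' : ∀ F → All NonEmpty F → ∀ f → f ∈ nextF F → InF' F f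
∈-nextF⇒InF' F nonEmpty f f∈ with ∈-nextF⁻ F f∈
... | h , h∈ , p , [] , _ , _ , refl = ⊥-elim (<-irrefl refl (All.lookup nonEmpty h∈))
... | h , h∈ , p , q ∷ Q , big , refl , refl =
  <-≤-trans (s≤s z≤n) (≤-trans (m≤n+m _ (length (oneIf p))) (≤-reflexive (sym (length-++ (oneIf p))))) ,
  ι (ψ (contract p (q ∷ Q))) , ρRel-expand p q Q big , lose h∈ refl

InF'⇒∈-nextF : ∀ F f → InF' F f → f ∈ nextF F
InF'⇒∈-nextF F f (_ , g , f→g , ιψF∋g) with find ιψF∋g
... | h , h∈ , refl = ∈-nextF⁺ F h∈ (ρRel-ιψ⁻¹ f→g)

All-QC-nextE : ∀ E → All QC E → All QC (nextE E)
All-QC-nextE E qcE = AllP.++⁺ qcE (All.tabulate (λ x∈ → QC-new (∈-nextE⁻ E x∈)))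
  where
  QC-new : ∀ {x} → ∃ (λ e → e ∈ E × ∃ λ P → All Big P × x ≡ expand P × contractCycle P ≡ e × length P ≡ length e) → QC x
  QC-new (_ , e∈ , P , big , refl , refl , length≡) =
    QC-expand P big (≤-trans (QC-length≥2 (All.lookup qcE e∈)) (≤-reflexive (sym length≡))) (All.lookup qcE e∈)

All-1∈-nextF : ∀ F → All (1 ∈_) F → All (1 ∈_) (nextF F)
All-1∈-nextF F ones = All.tabulate (λ f∈ → 1∈new (∈-nextF⁻ F f∈))
  where
  1∈new : ∀ {f} → ∃ (λ h → h ∈ F × ρPreimage h f) → 1 ∈ f
  1∈new (_ , h∈ , p , P , big , refl , refl) = 1∈contract⇒1∈expansion p P big (All.lookup ones h∈)

⊊ᶜ-Dih : ∀ {f c d} → Dih c d → f ⊊ᶜ d → f ⊊ᶜ c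
⊊ᶜ-Dih {f} c~d (f⊆d , f≁d) = ⊆ᶜ-Dih {f} c~d f⊆d , λ c~f → f≁d (Dih-trans (Dih-sym c~d) c~f)

next-covers : ∀ E F → Hyps E F → ∀ c → QC c → c ∈ᶜ nextE E ⊎ (∃ λ f → f ∈ nextF F × f ⊊ᶜ c)
next-covers E F (_ , _ , (00∈ , _) , _ , _) (a ∷ b ∷ []) q with QC-pair q
... | refl , refl = inj₁ (AnyP.++⁺ˡ 00∈)
next-covers E F (_ , _ , (_ , 111∈) , _ , _) (a ∷ b ∷ d ∷ []) q with QC-triple q
... | refl , refl , refl = inj₁ (AnyP.++⁺ˡ 111∈)
next-covers E F (_ , _ , _ , covers , _) c@(_ ∷ _ ∷ _ ∷ _ ∷ _) q
  with QC-blocks c q (s≤s (s≤s (s≤s (s≤s z≤n))))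
... | P , c~P , big , l with covers (contractCycle P) (QC-contractCycle P big l (qc-dih q c~P))
... | inj₁ E∋P with find E∋P
... | e , e∈ , e~P with contractCycle-Dih P e (Dih-sym e~P)
... | P′ , refl , P~P′ , bigP′ , _ =
  inj₁ (AnyP.++⁺ʳ E (lose (∈-nextE⁺ E P′ e∈ (bigP′ big) refl) (Dih-sym (Dih-trans c~P P~P′))))
next-covers E F (_ , nonEmpty , _ , covers , _) c@(_ ∷ _ ∷ _ ∷ _ ∷ _) q
  | P , c~P , big , l | inj₂ (f , f∈ , f⊆P , f≁P)
  with window-lift P f big l (All.lookup nonEmpty f∈) f⊆P f≁P
... | f′ , f′→ιψf , f′⊊P = inj₂ (f′ , ∈-nextF⁺ F f∈ (ρRel-ιψ⁻¹ f′→ιψf) , ⊊ᶜ-Dih {f′} c~P f′⊊P)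
next-covers E F _ [] q with QC-length≥2 q
... | ()
next-covers E F _ (_ ∷ []) q with QC-length≥2 q
... | s≤s ()

QC-ofLength : ∀ n → ∃ λ c → QC c × length c ≡ 2 + n
QC-ofLength zero    = 0 ∷ 0 ∷ [] , qc-base , refl
QC-ofLength (suc n) with QC-ofLength n
... | c₁ ∷ c₂ ∷ rest , q , l = suc c₁ ∷ 1 ∷ suc c₂ ∷ rest , qc-step q , cong suc l

length-∈ᶜ : ∀ E c → c ∈ᶜ E → length c ≤ sum (map length E)
length-∈ᶜ (e ∷ E) c (here e~c)  = ≤-trans (≤-reflexive (Dih-length e~c)) (m≤m+n _ _)
length-∈ᶜ (e ∷ E) c (there c∈E) = ≤-trans (length-∈ᶜ E c c∈E) (m≤n+m _ _)

-- A quiddity cycle longer than every member of E has to be covered by F.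
F-inhabited : ∀ E F → Hyps E F → ∃ λ f → f ∈ F
F-inhabited E F (_ , _ , _ , covers , _) with QC-ofLength (sum (map length E))
... | c , q , length≡ with covers c q
... | inj₁ c∈E = ⊥-elim (<⇒≱ (≤-trans (n≤1+n _) (≤-reflexive (sym length≡))) (length-∈ᶜ E c c∈E))
... | inj₂ (f , f∈ , _) = f , f∈

shortest : ∀ {F : List (List ℕ)} → ∃ (λ f → f ∈ F) → ∃ λ f₀ → f₀ ∈ F × ∀ {h} → h ∈ F → length f₀ ≤ length h
shortest {x ∷ F} _ = argmin length x F , member (argmin-sel length x F) , minimal
  where
  member : argmin length x F ≡ x ⊎ argmin length x F ∈ F → argmin length x F ∈ x ∷ F
  member (inj₁ ≡x) = here ≡x
  member (inj₂ ∈F) = there ∈F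
  minimal : ∀ {h} → h ∈ x ∷ F → length (argmin length x F) ≤ length h
  minimal (here refl) = f[argmin]≤v⁺ {f = length} x F (inj₁ ≤-refl)
  minimal (there h∈)  = f[argmin]≤v⁺ {f = length} x F (inj₂ (lose h∈ ≤-refl))

shorter-than-nextF : ∀ F (f₀ : List ℕ) → All (1 ∈_) F → (∀ {h} → h ∈ F → length f₀ ≤ length h) →
                     All (λ f → length f₀ < length f) (nextF F)
shorter-than-nextF F f₀ ones minimal = All.tabulate λ f∈ → longer (∈-nextF⁻ F f∈)
  where
  longer : ∀ {f} → ∃ (λ h → h ∈ F × ρPreimage h f) → length f₀ < length f
  longer (_ , h∈ , p , P , big , refl , refl) =
    <-≤-trans (s≤s (≤-trans (minimal h∈) (≤-reflexive (length-contract p P))))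
              (1∈contract⇒length< p P big (All.lookup ones h∈))

theorem2p10 : (E F : List (List ℕ)) → Hyps E F →
    ∃ λ E' → ∃ λ F' →
    (∀ c → (c ∈ᶜ E' → InE' E c) × (InE' E c → c ∈ᶜ E'))
    × (∀ f → (f ∈ F' → InF' F f) × (InF' F f → f ∈ F'))
    × Hyps E' F'
    × (∃ λ f → f ∈ F × All (λ f' → length f < length f') F')
theorem2p10 E F hyps@(qcE , nonEmpty , (00∈ , 111∈) , _ , ones) with shortest (F-inhabited E F hyps)
... | f₀ , f₀∈ , minimal =
  nextE E , nextF F ,
  (λ c → ∈ᶜ-nextE⁻ E qcE c , ∈ᶜ-nextE⁺ E c) ,
  (λ f → ∈-nextF⇒InF' F nonEmpty f , InF'⇒∈-nextF F f) ,
  (All-QC-nextE E qcE ,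
   All.tabulate (λ {f} f∈ → proj₁ (∈-nextF⇒InF' F nonEmpty f f∈)) ,
   (AnyP.++⁺ˡ 00∈ , AnyP.++⁺ˡ 111∈) ,
   next-covers E F hyps ,
   All-1∈-nextF F ones) ,
  (f₀ , f₀∈ , shorter-than-nextF F f₀ ones minimal)
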